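{- Let $k,r$ be positive integers with $r<k$ and $\mathbf p$ a tuple of non-negative integers with $\mathcal S_{\mathbf p,r}\neq\emptyset$. Let $M_\gamma=(M_{\gamma,i,j})_{i,j\in[k]}$ be the matrix of generalized events on $\Omega$ with $M_{\gamma,i,j}=J^{f(i)}_{i,j+1}-J^{f(i)}_{i-1,j+1}$ for $i\in[k-1]$, $j\in[k]$, and $M_{\gamma,k,j}=\Omega$. For $a\in[k]$ let $Q^{(a)}=(Q^{(a)}_{i,j})_{i,j\in[k]}$ be the matrix with $Q^{(a)}_{i,j}=J^{f(i)}_{i,j+1}$ for $i\in[a-1]$, $Q^{(a)}_{i,j}=J^{f(i-1)}_{i,j+1}$ for $i\in\{a+1,\ldots,k\}$, and $Q^{(a)}_{a,j}=\Omega$. Then $$\mathrm{Pdet}(M_\gamma)=\sum_{a=1}^k\mathrm{Pdet}(Q^{(a)}).$$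
   Context: Indices are taken modulo $k$ with $0$ meaning $k$; $]i,j]=\{i+1,\ldots,j\}$ cyclically modulo $k$. $\mathcal S_{\mathbf p,r}$: tuples $(S_1,\ldots,S_r)$ of subsets of $[k]$ with each $j\in[k]$ in exactly $p_j$ of the $S_i$. $\Omega$ is the set of pairs $(\mathbf S,f)$ with $\mathbf S\in\mathcal S_{\mathbf p,r}$ and $f$ a surjection $[k-1]\to[r]$, with uniform probability $\Pr$. For $t\in[r]$: $J^t_{i,j}=\{(\mathbf S,f)\in\Omega:]i,j]\subseteq S_t\}$ if $i\neq j$, and $J^t_{i,i}=\{(\mathbf S,f):S_t=[k]\}$; $J^{f(m)}_{i,j}$ denotes this event with $t$ replaced by $f(m)$. Generalized events are formal $\mathbb C$-linear combinations of events, with $\cap$ extended bilinearly and $\Pr$ linearly; $\mathrm{Pdet}(M)=\sum_{\pi\in\mathfrak S_k}\varepsilon(\pi)\Pr(M_{1,\pi(1)}\cap\cdots\cap M_{k,\pi(k)})$. -}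

module Defs where

open import Data.Bool using (Bool; true; false; _∧_; _∨_; not; if_then_else_)
open import Data.Nat using (ℕ; zero; suc; _∸_; _≡ᵇ_; _≤ᵇ_; _<ᵇ_; _+_; _%_)
open import Data.Integer using (ℤ; +_; -_) renaming (_*_ to _*ℤ_; _+_ to _+ℤ_)
open import Data.Rational using (ℚ; _/_) renaming (0ℚ to 0q)
import Data.Rational as Q
open import Data.List using (List; []; _∷_; [_]; map; concatMap; filterᵇ; length; foldr; upTo; _++_)
open import Data.Vec using (Vec; []; _∷_)
open import Data.Bool.ListAction using (all; any)
open import Data.Product using (_×_; _,_; ∃)
open import Relation.Binary.PropositionalEquality using (_≡_)

-- Conventions: elements of [n] = {1,…,n} are natural numbers 1..n.
-- A vector v : Vec A n is read 1-based: (get d v i) is its i-th entry,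
-- and the default d is returned for i ∉ [n] (never used in the theorem).

get : {A : Set} {n : ℕ} → A → Vec A n → ℕ → A
get d [] _ = d
get d (x ∷ xs) zero = d
get d (x ∷ xs) (suc zero) = x
get d (x ∷ xs) (suc (suc i)) = get d xs (suc i)

range : ℕ → List ℕ
range n = map suc (upTo n)

allVec : {A : Set} → List A → (n : ℕ) → List (Vec A n)
allVec xs zero = [ [] ]
allVec xs (suc n) = concatMap (λ x → map (x ∷_) (allVec xs n)) xs

-- Subsets of [k] as characteristic vectors; a tuple (S_1,…,S_r).

Subset : ℕ → Set
Subset k = Vec Bool k

_∈S_ : {k : ℕ} → ℕ → Subset k → Bool
m ∈S S = get false S m

Tuple : ℕ → ℕ → Set
Tuple k r = Vec (Subset k) r

comp : {k r : ℕ} → Tuple k r → ℕ → Subset k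
comp {k} S t = get (Data.Vec.replicate k false) S t

inSpr : (k r : ℕ) → Vec ℕ k → Tuple k r → Bool
inSpr k r p S =
  all (λ j → length (filterᵇ (λ t → j ∈S comp S t) (range r)) ≡ᵇ get 0 p j) (range k)

-- f : [k-1] → [r] stored as the vector (f(1),…,f(k-1)) with entries in [r]
Fun : ℕ → Set
Fun k = Vec ℕ (k ∸ 1)

app : {k : ℕ} → Fun k → ℕ → ℕ
app f i = get 0 f i

isSurj : (k r : ℕ) → Fun k → Bool
isSurj k r f = all (λ t → any (λ i → app {k} f i ≡ᵇ t) (range (k ∸ 1))) (range r)

Pt : ℕ → ℕ → Set
Pt k r = Tuple k r × Fun k

Ω : (k r : ℕ) → Vec ℕ k → List (Pt k r)
Ω k r p =
  filterᵇ (λ { (S , f) → inSpr k r p S ∧ isSurj k r f })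
    (concatMap (λ S → map (S ,_) (allVec (range r) (k ∸ 1)))
               (allVec (allVec (true ∷ false ∷ []) k) r))

Event : ℕ → ℕ → Set
Event k r = Pt k r → Bool

-- Cyclic intervals ]i,j] ⊆ [k], indices taken modulo k (0 meaning k).

modk : ℕ → ℕ → ℕ
modk zero x = x
modk (suc k) x = x % suc k

-- m ∈ ]i,j] = {i+1,…,j} cyclically mod k  (empty if i ≡ j mod k)
inIv : ℕ → ℕ → ℕ → ℕ → Bool
inIv k i j m =
  let d   = modk k (modk k m + k ∸ modk k i)
      len = modk k (modk k j + k ∸ modk k i)
  in (1 ≤ᵇ d) ∧ (d ≤ᵇ len)

JS : (k : ℕ) → Subset k → ℕ → ℕ → Bool
JS k St i j =
  if modk k i ≡ᵇ modk k j
  then all (λ m → m ∈S St) (range k)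
  else all (λ m → not (inIv k i j m) ∨ (m ∈S St)) (range k)

Jf : (k r : ℕ) → ℕ → ℕ → ℕ → Event k r
Jf k r m i j (S , f) = JS k (comp S (app {k} f m)) i j

-- Generalized events: formal linear combinations Σ c_e · E_e of events
-- (integer coefficients suffice here), ∩ extended bilinearly, Pr linearly.

GEvent : ℕ → ℕ → Set
GEvent k r = List (ℤ × Event k r)

ev : {k r : ℕ} → Event k r → GEvent k r
ev E = [ (+ 1 , E) ]

ΩE : {k r : ℕ} → GEvent k r
ΩE = ev (λ _ → true)

_⊖_ : {k r : ℕ} → GEvent k r → GEvent k r → GEvent k r
A ⊖ B = A ++ map (λ { (c , E) → (- c , E) }) B

_∩_ : {k r : ℕ} → GEvent k r → GEvent k r → GEvent k r
A ∩ B = concatMap (λ { (c , E) → map (λ { (d , F) → (c *ℤ d , λ ω → E ω ∧ F ω) }) B }) A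

-- rational number z / n, with the (unused) convention z / 0 = 0
divℚ : ℤ → ℕ → ℚ
divℚ z zero = 0q
divℚ z (suc n) = z / suc n

PrE : (k r : ℕ) → Vec ℕ k → Event k r → ℚ
PrE k r p E = divℚ (+ length (filterᵇ E (Ω k r p))) (length (Ω k r p))

Pr : (k r : ℕ) → Vec ℕ k → GEvent k r → ℚ
Pr k r p A = foldr (λ { (c , E) acc → divℚ c 1 Q.* PrE k r p E Q.+ acc }) 0q A

insertAll : ℕ → List ℕ → List (List ℕ)
insertAll x [] = [ x ∷ [] ]
insertAll x (y ∷ ys) = (x ∷ y ∷ ys) ∷ map (y ∷_) (insertAll x ys)

perms : List ℕ → List (List ℕ)
perms [] = [ [] ]
perms (x ∷ xs) = concatMap (insertAll x) (perms xs)

inversions : List ℕ → ℕ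
inversions [] = 0
inversions (x ∷ xs) = length (filterᵇ (λ y → y <ᵇ x) xs) + inversions xs

even : ℕ → Bool
even zero = true
even (suc n) = not (even n)

sign : List ℕ → ℤ
sign π = if even (inversions π) then + 1 else - (+ 1)

rowsCap : {k r : ℕ} → (ℕ → ℕ → GEvent k r) → ℕ → List ℕ → GEvent k r
rowsCap M i [] = ΩE
rowsCap M i (πi ∷ π) = M i πi ∩ rowsCap M (suc i) π

Pdet : (k r : ℕ) → Vec ℕ k → (ℕ → ℕ → GEvent k r) → ℚ
Pdet k r p M =
  foldr Q._+_ 0q (map (λ π → divℚ (sign π) 1 Q.* Pr k r p (rowsCap M 1 π)) (perms (range k)))

sumℚ : List ℚ → ℚ
sumℚ = foldr Q._+_ 0q

Mγ : (k r : ℕ) → ℕ → ℕ → GEvent k r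
Mγ k r i j =
  if i <ᵇ k
  then ev (Jf k r i i (suc j)) ⊖ ev (Jf k r i (i ∸ 1) (suc j))
  else ΩE

Qa : (k r : ℕ) → ℕ → ℕ → ℕ → GEvent k r
Qa k r a i j =
  if i <ᵇ a then ev (Jf k r i i (suc j))
  else if i ≡ᵇ a then ΩE
  else ev (Jf k r (i ∸ 1) i (suc j))

-- By multilinearity of Pdet and linearity of Pr, Pdet(M) = |Ω|⁻¹ ∑_ω det M(ω), where M(ω) is the integer
-- matrix of the values of the generalised events at ω; so it suffices to compare the sums over Ω of these
-- determinants. Exchanging f(q) and f(q + 1) is a bijection of Ω; combined with exchanging two adjacent rows
-- carrying the labels f(q), f(q + 1) it changes the sign of the sum, and in particular the sum vanishes when two
-- adjacent rows J^{f(q)}_{i,·}, J^{f(q+1)}_{i,·} have the same interval start i. Expanding the difference rows of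
-- M_γ one at a time from the top, the row J^{f(m)}_{m,·} chosen at step m makes all later difference rows collapse
-- to J^{f(i)}_{i,·} by this vanishing, and bubbling rows by such exchanges turns the resulting matrix into ±Q^{(m)};
-- the signs cancel, and the expansion telescopes to ∑_a Pdet(Q^{(a)}).

module Submission where

open import Defs
open import Data.Nat using (ℕ; _<_)
open import Data.Vec using (Vec)
open import Data.Bool using (true)
open import Data.List using (map)
open import Data.Product using (∃)
open import Relation.Binary.PropositionalEquality using (_≡_)

open import Data.Bool using (Bool; false; T; not; _∧_; _∨_; if_then_else_)
import Data.Bool.Properties as Bool
open import Data.Bool.ListAction using (any; all; or; and)
open import Data.Unit using (⊤; tt)
open import Data.Nat as ℕ using (zero; suc; _≤_; _<ᵇ_; _≤ᵇ_; _≡ᵇ_; _∸_; s≤s; z≤n)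
import Data.Nat.Properties as ℕ
import Data.Nat.DivMod as ℕ
open import Data.Integer using (ℤ; +_; -_; -[1+_]; _+_; _*_; _-_)
import Data.Integer.Properties as ℤ
open import Data.Integer.Tactic.RingSolver using (solve-∀)
import Data.Rational as ℚ
import Data.Rational.Properties as ℚ
import Data.Rational.Unnormalised as ℚᵘ
import Data.Rational.Unnormalised.Properties as ℚᵘ
open import Data.List using (List; []; _∷_; _++_; [_]; concatMap; filterᵇ; length; foldr; applyUpTo)
import Data.List.Properties as List
open import Data.List.Relation.Binary.Pointwise as Pointwise using (Pointwise; []; _∷_)
open import Data.List.Relation.Unary.All as All using (All; []; _∷_)
import Data.List.Relation.Unary.All.Properties as All
open import Data.Vec using ([]; _∷_; toList)
open import Data.Product using (_,_; proj₁; proj₂)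
open import Function using (_∘_; _∘′_; id; Equivalence)
open import Relation.Binary.PropositionalEquality
  using (_≢_; refl; sym; trans; cong; cong₂; subst; module ≡-Reasoning)

fromℚᵘ-homo-+ : ∀ p q → ℚ.fromℚᵘ (p ℚᵘ.+ q) ≡ ℚ.fromℚᵘ p ℚ.+ ℚ.fromℚᵘ q
fromℚᵘ-homo-+ p q = ℚ.toℚᵘ-injective (ℚᵘ.≃-trans (ℚ.toℚᵘ-fromℚᵘ (p ℚᵘ.+ q))
  (ℚᵘ.≃-sym (ℚᵘ.≃-trans (ℚ.toℚᵘ-homo-+ (ℚ.fromℚᵘ p) (ℚ.fromℚᵘ q))
     (ℚᵘ.+-cong (ℚ.toℚᵘ-fromℚᵘ p) (ℚ.toℚᵘ-fromℚᵘ q)))))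

fromℚᵘ-homo-* : ∀ p q → ℚ.fromℚᵘ (p ℚᵘ.* q) ≡ ℚ.fromℚᵘ p ℚ.* ℚ.fromℚᵘ q
fromℚᵘ-homo-* p q = ℚ.toℚᵘ-injective (ℚᵘ.≃-trans (ℚ.toℚᵘ-fromℚᵘ (p ℚᵘ.* q))
  (ℚᵘ.≃-sym (ℚᵘ.≃-trans (ℚ.toℚᵘ-homo-* (ℚ.fromℚᵘ p) (ℚ.fromℚᵘ q))
     (ℚᵘ.*-cong (ℚ.toℚᵘ-fromℚᵘ p) (ℚ.toℚᵘ-fromℚᵘ q)))))

divℚ-0 : ∀ N → divℚ (+ 0) N ≡ ℚ.0ℚ
divℚ-0 zero = refl
divℚ-0 (suc n) = ℚ.0/n≡0 (suc n)

divℚ-+ : ∀ N a b → divℚ (a + b) N ≡ divℚ a N ℚ.+ divℚ b N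
divℚ-+ zero a b = refl
divℚ-+ (suc n) a b = trans (ℚ.fromℚᵘ-cong sum≃) (fromℚᵘ-homo-+ (ℚᵘ.mkℚᵘ a n) (ℚᵘ.mkℚᵘ b n))
  where
  distrib : ∀ a b d → (a + b) * (d * d) ≡ (a * d + b * d) * d
  distrib = solve-∀
  sum≃ : ℚᵘ.mkℚᵘ (a + b) n ℚᵘ.≃ ℚᵘ.mkℚᵘ a n ℚᵘ.+ ℚᵘ.mkℚᵘ b n
  sum≃ = ℚᵘ.*≡* (trans (cong ((a + b) *_) (sym (ℤ.pos-* (suc n) (suc n)))) (distrib a b (+ suc n)))

divℚ-*-integer : ∀ N c z → divℚ c 1 ℚ.* divℚ z N ≡ divℚ (c * z) N
divℚ-*-integer zero c z = ℚ.*-zeroʳ (divℚ c 1)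
divℚ-*-integer (suc n) c z = sym (trans (ℚ.fromℚᵘ-cong product≃) (fromℚᵘ-homo-* (ℚᵘ.mkℚᵘ c 0) (ℚᵘ.mkℚᵘ z n)))
  where
  product≃ : ℚᵘ.mkℚᵘ (c * z) n ℚᵘ.≃ ℚᵘ.mkℚᵘ c 0 ℚᵘ.* ℚᵘ.mkℚᵘ z n
  product≃ = ℚᵘ.*≡* (trans (cong ((c * z) *_) (sym (ℤ.pos-* 1 (suc n)))) (unit c z (+ suc n)))
    where
    unit : ∀ c z d → (c * z) * (+ 1 * d) ≡ (c * z) * d
    unit = solve-∀

∑ : {A : Set} → (A → ℤ) → List A → ℤ
∑ f [] = + 0
∑ f (x ∷ xs) = f x + ∑ f xs

module _ {A : Set} where

  ∑-cong : {f g : A → ℤ} (xs : List A) → (∀ x → f x ≡ g x) → ∑ f xs ≡ ∑ g xs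
  ∑-cong [] e = refl
  ∑-cong (x ∷ xs) e = cong₂ _+_ (e x) (∑-cong xs e)

  ∑-zero : (xs : List A) → ∑ (λ _ → + 0) xs ≡ + 0
  ∑-zero [] = refl
  ∑-zero (x ∷ xs) = trans (ℤ.+-identityˡ _) (∑-zero xs)

  ∑-+ : (f g : A → ℤ) (xs : List A) → ∑ (λ x → f x + g x) xs ≡ ∑ f xs + ∑ g xs
  ∑-+ f g [] = refl
  ∑-+ f g (x ∷ xs) = trans (cong (_+_ (f x + g x)) (∑-+ f g xs)) (interchange (f x) (g x) (∑ f xs) (∑ g xs))
    where
    interchange : ∀ a b c d → a + b + (c + d) ≡ a + c + (b + d)
    interchange = solve-∀

  ∑-*ˡ : (c : ℤ) (f : A → ℤ) (xs : List A) → ∑ (λ x → c * f x) xs ≡ c * ∑ f xs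
  ∑-*ˡ c f [] = sym (ℤ.*-zeroʳ c)
  ∑-*ˡ c f (x ∷ xs) = trans (cong (_+_ (c * f x)) (∑-*ˡ c f xs)) (sym (ℤ.*-distribˡ-+ c (f x) (∑ f xs)))

  ∑-neg : (f : A → ℤ) (xs : List A) → ∑ (λ x → - f x) xs ≡ - ∑ f xs
  ∑-neg f [] = refl
  ∑-neg f (x ∷ xs) = trans (cong (_+_ (- f x)) (∑-neg f xs)) (sym (ℤ.neg-distrib-+ (f x) (∑ f xs)))

  ∑-++ : (f : A → ℤ) (xs ys : List A) → ∑ f (xs ++ ys) ≡ ∑ f xs + ∑ f ys
  ∑-++ f [] ys = sym (ℤ.+-identityˡ _)
  ∑-++ f (x ∷ xs) ys = trans (cong (_+_ (f x)) (∑-++ f xs ys)) (sym (ℤ.+-assoc (f x) _ _))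

module _ {A B : Set} where

  ∑-map : (f : B → ℤ) (g : A → B) (xs : List A) → ∑ f (map g xs) ≡ ∑ (f ∘ g) xs
  ∑-map f g [] = refl
  ∑-map f g (x ∷ xs) = cong (_+_ (f (g x))) (∑-map f g xs)

  ∑-concatMap : (f : B → ℤ) (g : A → List B) (xs : List A) →
    ∑ f (concatMap g xs) ≡ ∑ (λ x → ∑ f (g x)) xs
  ∑-concatMap f g [] = refl
  ∑-concatMap f g (x ∷ xs) =
    trans (∑-++ f (g x) (concatMap g xs)) (cong (_+_ (∑ f (g x))) (∑-concatMap f g xs))

  ∑-comm : (f : A → B → ℤ) (xs : List A) (ys : List B) →
    ∑ (λ x → ∑ (f x) ys) xs ≡ ∑ (λ y → ∑ (λ x → f x y) xs) ys
  ∑-comm f [] ys = sym (∑-zero ys)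
  ∑-comm f (x ∷ xs) ys = trans (cong (_+_ (∑ (f x) ys)) (∑-comm f xs ys))
                               (sym (∑-+ (f x) (λ y → ∑ (λ x' → f x' y) xs) ys))

∑-cong-All : {A : Set} {P : A → Set} {f g : A → ℤ} (xs : List A) → All P xs →
  (∀ x → P x → f x ≡ g x) → ∑ f xs ≡ ∑ g xs
∑-cong-All [] [] e = refl
∑-cong-All (x ∷ xs) (px ∷ pxs) e = cong₂ _+_ (e x px) (∑-cong-All xs pxs e)

-- Generalised events as integer-valued functions on Ω

⟦_⟧ : Bool → ℤ
⟦ true ⟧ = + 1
⟦ false ⟧ = + 0

⟦∧⟧ : ∀ a b → ⟦ a ∧ b ⟧ ≡ ⟦ a ⟧ * ⟦ b ⟧
⟦∧⟧ true true = refl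
⟦∧⟧ true false = refl
⟦∧⟧ false b = refl

filterᵇ-≗-if : {A : Set} (P : A → Bool) (x : A) (xs : List A) →
  filterᵇ P (x ∷ xs) ≡ (if P x then x ∷ filterᵇ P xs else filterᵇ P xs)
filterᵇ-≗-if P x xs = by-cases (P x) refl
  where
  by-cases : (b : Bool) → P x ≡ b → filterᵇ P (x ∷ xs) ≡ (if b then x ∷ filterᵇ P xs else filterᵇ P xs)
  by-cases true eq = List.filter-accept (Bool.T? ∘ P) (subst T (sym eq) tt)
  by-cases false eq = List.filter-reject (Bool.T? ∘ P) (subst T eq)

module _ {A : Set} where

  length-filterᵇ≡∑ : (P : A → Bool) (xs : List A) → + length (filterᵇ P xs) ≡ ∑ (⟦_⟧ ∘ P) xs
  length-filterᵇ≡∑ P [] = refl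
  length-filterᵇ≡∑ P (x ∷ xs) rewrite filterᵇ-≗-if P x xs with P x
  ... | true = trans (ℤ.pos-+ 1 (length (filterᵇ P xs))) (cong (_+_ (+ 1)) (length-filterᵇ≡∑ P xs))
  ... | false = trans (length-filterᵇ≡∑ P xs) (sym (ℤ.+-identityˡ _))

  ∑-filterᵇ : (P : A → Bool) (f : A → ℤ) (xs : List A) →
    ∑ f (filterᵇ P xs) ≡ ∑ (λ x → ⟦ P x ⟧ * f x) xs
  ∑-filterᵇ P f [] = refl
  ∑-filterᵇ P f (x ∷ xs) rewrite filterᵇ-≗-if P x xs with P x
  ... | true = cong₂ _+_ (sym (ℤ.*-identityˡ (f x))) (∑-filterᵇ P f xs)
  ... | false = trans (∑-filterᵇ P f xs) (sym (ℤ.+-identityˡ _))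

module _ {k r : ℕ} where

  value : GEvent k r → Pt k r → ℤ
  value A ω = ∑ (λ cE → proj₁ cE * ⟦ proj₂ cE ω ⟧) A

  value-ev : (E : Event k r) (ω : Pt k r) → value (ev E) ω ≡ ⟦ E ω ⟧
  value-ev E ω = trans (ℤ.+-identityʳ _) (ℤ.*-identityˡ _)

  value-⊖ : (A B : GEvent k r) (ω : Pt k r) → value (A ⊖ B) ω ≡ value A ω - value B ω
  value-⊖ A B ω = trans (∑-++ _ A _) (cong (_+_ (value A ω)) (begin
      ∑ _ (map _ B)                                ≡⟨ ∑-map _ _ B ⟩
      ∑ (λ cE → - proj₁ cE * ⟦ proj₂ cE ω ⟧) B     ≡⟨ ∑-cong B (λ cE → sym (ℤ.neg-distribˡ-* (proj₁ cE) _)) ⟩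
      ∑ (λ cE → - (proj₁ cE * ⟦ proj₂ cE ω ⟧)) B   ≡⟨ ∑-neg _ B ⟩
      - value B ω                                  ∎))
    where open ≡-Reasoning

  value-∩ : (A B : GEvent k r) (ω : Pt k r) → value (A ∩ B) ω ≡ value A ω * value B ω
  value-∩ [] B ω = refl
  value-∩ ((c , E) ∷ A) B ω = begin
      value (((c , E) ∷ A) ∩ B) ω                    ≡⟨ ∑-++ _ (map _ B) (A ∩ B) ⟩
      ∑ _ (map _ B) + value (A ∩ B) ω                ≡⟨ cong₂ _+_ first-row (value-∩ A B ω) ⟩
      c * ⟦ E ω ⟧ * value B ω + value A ω * value B ω ≡⟨ sym (ℤ.*-distribʳ-+ (value B ω) (c * ⟦ E ω ⟧) (value A ω)) ⟩
      value ((c , E) ∷ A) ω * value B ω               ∎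
    where
    open ≡-Reasoning
    regroup : ∀ c d e f → c * d * (e * f) ≡ c * e * (d * f)
    regroup = solve-∀
    first-row : ∑ _ (map _ B) ≡ c * ⟦ E ω ⟧ * value B ω
    first-row = trans (∑-map _ _ B) (trans (∑-cong B (λ dF →
        trans (cong (c * proj₁ dF *_) (⟦∧⟧ (E ω) (proj₂ dF ω))) (regroup c (proj₁ dF) _ _)))
      (∑-*ˡ (c * ⟦ E ω ⟧) (λ dF → proj₁ dF * ⟦ proj₂ dF ω ⟧) B))

-- Determinants by Laplace expansion

sgn : ℕ → ℤ
sgn zero = + 1
sgn (suc n) = - sgn n

sgn-+ : ∀ m n → sgn (m ℕ.+ n) ≡ sgn m * sgn n
sgn-+ zero n = sym (ℤ.*-identityˡ (sgn n))
sgn-+ (suc m) n = trans (cong -_ (sgn-+ m n)) (ℤ.neg-distribˡ-* (sgn m) (sgn n))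

sgn-square : ∀ n → sgn n * sgn n ≡ + 1
sgn-square zero = refl
sgn-square (suc n) = trans (sym (ℤ.neg-distribˡ-* (sgn n) (- sgn n)))
  (trans (cong -_ (sym (ℤ.neg-distribʳ-* (sgn n) (sgn n)))) (trans (ℤ.neg-involutive _) (sgn-square n)))

sign≡sgn-inversions : ∀ π → sign π ≡ sgn (inversions π)
sign≡sgn-inversions π = parity (inversions π)
  where
  parity : ∀ n → (if even n then + 1 else - (+ 1)) ≡ sgn n
  parity zero = refl
  parity (suc n) with even n | parity n
  ... | true | e = cong -_ e
  ... | false | e = cong -_ e

-- alternatingSum g (x₀ ∷ x₁ ∷ …) = ∑ᵢ (-1)ⁱ g xᵢ (the list without xᵢ)

module _ {A : Set} where

  alternatingSum : (A → List A → ℤ) → List A → ℤ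
  alternatingSum g [] = + 0
  alternatingSum g (x ∷ xs) = g x xs - alternatingSum (λ y rest → g y (x ∷ rest)) xs

  alternatingSum-cong : {g h : A → List A → ℤ} (xs : List A) →
    (∀ y rest → g y rest ≡ h y rest) → alternatingSum g xs ≡ alternatingSum h xs
  alternatingSum-cong [] e = refl
  alternatingSum-cong (x ∷ xs) e = cong₂ _-_ (e x xs) (alternatingSum-cong xs (λ y rest → e y (x ∷ rest)))

  alternatingSum-cong-length : (n : ℕ) {g h : A → List A → ℤ} (xs : List A) → length xs ≡ suc n →
    (∀ y rest → length rest ≡ n → g y rest ≡ h y rest) → alternatingSum g xs ≡ alternatingSum h xs
  alternatingSum-cong-length n (x ∷ []) len e = cong (_- + 0) (e x [] (ℕ.suc-injective len))
  alternatingSum-cong-length (suc n) (x ∷ y ∷ xs) len e =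
    cong₂ _-_ (e x (y ∷ xs) (ℕ.suc-injective len))
      (alternatingSum-cong-length n (y ∷ xs) (ℕ.suc-injective len) (λ z rest l → e z (x ∷ rest) (cong suc l)))

  alternatingSum-neg : (g : A → List A → ℤ) (xs : List A) →
    alternatingSum (λ y rest → - g y rest) xs ≡ - alternatingSum g xs
  alternatingSum-neg g [] = refl
  alternatingSum-neg g (x ∷ xs) =
    trans (cong (_-_ (- g x xs)) (alternatingSum-neg (λ y rest → g y (x ∷ rest)) xs))
          (sym (ℤ.neg-distrib-+ (g x xs) _))

  alternatingSum-difference : (g h : A → List A → ℤ) (xs : List A) →
    alternatingSum (λ y rest → g y rest - h y rest) xs ≡ alternatingSum g xs - alternatingSum h xs
  alternatingSum-difference g h [] = refl
  alternatingSum-difference g h (x ∷ xs) =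
    trans (cong (_-_ (g x xs - h x xs)) (alternatingSum-difference (λ y rest → g y (x ∷ rest)) (λ y rest → h y (x ∷ rest)) xs))
          (interchange (g x xs) (h x xs) _ _)
    where
    interchange : ∀ a b c d → a - b - (c - d) ≡ a - c - (b - d)
    interchange = solve-∀

  alternatingSum-*ˡ : (c : ℤ) (g : A → List A → ℤ) (xs : List A) →
    alternatingSum (λ y rest → c * g y rest) xs ≡ c * alternatingSum g xs
  alternatingSum-*ˡ c g [] = sym (ℤ.*-zeroʳ c)
  alternatingSum-*ˡ c g (x ∷ xs) =
    trans (cong (_-_ (c * g x xs)) (alternatingSum-*ˡ c (λ y rest → g y (x ∷ rest)) xs))
          (factor c (g x xs) _)
    where
    factor : ∀ c a b → c * a - c * b ≡ c * (a - b)
    factor = solve-∀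

  alternatingSum-++ : (g : A → List A → ℤ) (xs ys : List A) →
    alternatingSum g (xs ++ ys) ≡
      alternatingSum (λ y rest → g y (rest ++ ys)) xs + sgn (length xs) * alternatingSum (λ y rest → g y (xs ++ rest)) ys
  alternatingSum-++ g [] ys = sym (trans (ℤ.+-identityˡ _) (ℤ.*-identityˡ _))
  alternatingSum-++ g (x ∷ xs) ys =
    trans (cong (_-_ (g x (xs ++ ys))) (alternatingSum-++ (λ y rest → g y (x ∷ rest)) xs ys))
          (regroup (g x (xs ++ ys)) _ (sgn (length xs)) _)
    where
    regroup : ∀ a b s c → a - (b + s * c) ≡ a - b + (- s) * c
    regroup = solve-∀

module _ {A B : Set} where

  ∑-alternatingSum : (g : B → A → List A → ℤ) (bs : List B) (xs : List A) →
    ∑ (λ b → alternatingSum (g b) xs) bs ≡ alternatingSum (λ y rest → ∑ (λ b → g b y rest) bs) xs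
  ∑-alternatingSum g bs [] = ∑-zero bs
  ∑-alternatingSum g bs (x ∷ xs) = begin
      ∑ (λ b → g b x xs - alternatingSum (λ y rest → g b y (x ∷ rest)) xs) bs
        ≡⟨ ∑-+ (λ b → g b x xs) (λ b → - alternatingSum (λ y rest → g b y (x ∷ rest)) xs) bs ⟩
      ∑ (λ b → g b x xs) bs + ∑ (λ b → - alternatingSum (λ y rest → g b y (x ∷ rest)) xs) bs
        ≡⟨ cong (_+_ (∑ (λ b → g b x xs) bs)) (∑-neg _ bs) ⟩
      ∑ (λ b → g b x xs) bs - ∑ (λ b → alternatingSum (λ y rest → g b y (x ∷ rest)) xs) bs
        ≡⟨ cong (_-_ (∑ (λ b → g b x xs) bs)) (∑-alternatingSum (λ b y rest → g b y (x ∷ rest)) bs xs) ⟩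
      alternatingSum (λ y rest → ∑ (λ b → g b y rest) bs) (x ∷ xs) ∎
    where open ≡-Reasoning

  alternatingSum-pointwise : (R : A → B → Set) {g : A → List A → ℤ} {h : B → List B → ℤ}
    {xs : List A} {ys : List B} → Pointwise R xs ys →
    (∀ {x y rest rest′} → R x y → Pointwise R rest rest′ → g x rest ≡ h y rest′) →
    alternatingSum g xs ≡ alternatingSum h ys
  alternatingSum-pointwise R [] e = refl
  alternatingSum-pointwise R (x∼y ∷ xs∼ys) e =
    cong₂ _-_ (e x∼y xs∼ys) (alternatingSum-pointwise R xs∼ys (λ x′∼y′ rest∼ → e x′∼y′ (x∼y ∷ rest∼)))

-- det e n rows c: the n × n determinant with entries e row j for the given rows and the
-- columns j = c, c+1, …, c+n-1, by Laplace expansion along the first column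

det : {A : Set} → (A → ℕ → ℤ) → ℕ → List A → ℕ → ℤ
det e zero [] c = + 1
det e zero (_ ∷ _) c = + 0
det e (suc n) rows c = alternatingSum (λ y rest → e y c * det e n rest (suc c)) rows

module _ {A : Set} (e : A → ℕ → ℤ) where

  det-swap : ∀ n (pre : List A) a b post c →
    det e n (pre ++ a ∷ b ∷ post) c ≡ - det e n (pre ++ b ∷ a ∷ post) c
  det-swap zero [] a b post c = refl
  det-swap zero (_ ∷ _) a b post c = refl
  det-swap (suc n) pre a b post c =
    trans (alternatingSum-++ G pre (a ∷ b ∷ post))
    (trans (cong₂ (λ u v → u + sgn (length pre) * (G a (pre ++ b ∷ post) - (G b (pre ++ a ∷ post) - v))) above below)
    (trans (regroup (alternatingSum (λ y rest → G y (rest ++ b ∷ a ∷ post)) pre) (sgn (length pre))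
                    (G a (pre ++ b ∷ post)) (G b (pre ++ a ∷ post))
                    (alternatingSum (λ y rest → G y (pre ++ b ∷ a ∷ rest)) post))
      (cong -_ (sym (alternatingSum-++ G pre (b ∷ a ∷ post))))))
    where
    G : A → List A → ℤ
    G y rest = e y c * det e n rest (suc c)
    G-swap : ∀ y pre′ post′ → G y (pre′ ++ a ∷ b ∷ post′) ≡ - G y (pre′ ++ b ∷ a ∷ post′)
    G-swap y pre′ post′ = trans (cong (e y c *_) (det-swap n pre′ a b post′ (suc c))) (sym (ℤ.neg-distribʳ-* (e y c) _))
    above : alternatingSum (λ y rest → G y (rest ++ a ∷ b ∷ post)) pre ≡ - alternatingSum (λ y rest → G y (rest ++ b ∷ a ∷ post)) pre
    above = trans (alternatingSum-cong pre (λ y rest → G-swap y rest post)) (alternatingSum-neg _ pre)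
    below : alternatingSum (λ y rest → G y (pre ++ a ∷ b ∷ rest)) post ≡ - alternatingSum (λ y rest → G y (pre ++ b ∷ a ∷ rest)) post
    below = trans (alternatingSum-cong post (λ y rest → G-swap y pre rest)) (alternatingSum-neg _ post)
    regroup : ∀ P s A B X → - P + s * (A - (B - - X)) ≡ - (P + s * (B - (A - X)))
    regroup = solve-∀

  det-linear : ∀ n (pre : List A) x y z post c → (∀ j → e x j ≡ e y j - e z j) →
    det e n (pre ++ x ∷ post) c ≡ det e n (pre ++ y ∷ post) c - det e n (pre ++ z ∷ post) c
  det-linear zero [] x y z post c x≡y-z = refl
  det-linear zero (_ ∷ _) x y z post c x≡y-z = refl
  det-linear (suc n) pre x y z post c x≡y-z =
    trans (alternatingSum-++ G pre (x ∷ post))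
    (trans (cong₂ (λ u v → u + sgn (length pre) * (e x c * det e n (pre ++ post) (suc c) - v)) above below)
    (trans (cong (λ ex → Py - Pz + sgn (length pre) * (ex * det e n (pre ++ post) (suc c) - (Ty - Tz))) (x≡y-z c))
    (trans (regroup Py Pz (sgn (length pre)) (e y c) (e z c) (det e n (pre ++ post) (suc c)) Ty Tz)
      (cong₂ _-_ (sym (alternatingSum-++ G pre (y ∷ post))) (sym (alternatingSum-++ G pre (z ∷ post)))))))
    where
    G : A → List A → ℤ
    G w rest = e w c * det e n rest (suc c)
    Py Pz Ty Tz : ℤ
    Py = alternatingSum (λ w rest → G w (rest ++ y ∷ post)) pre
    Pz = alternatingSum (λ w rest → G w (rest ++ z ∷ post)) pre
    Ty = alternatingSum (λ w rest → G w (pre ++ y ∷ rest)) post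
    Tz = alternatingSum (λ w rest → G w (pre ++ z ∷ rest)) post
    G-linear : ∀ w pre′ post′ → G w (pre′ ++ x ∷ post′) ≡ G w (pre′ ++ y ∷ post′) - G w (pre′ ++ z ∷ post′)
    G-linear w pre′ post′ = trans (cong (e w c *_) (det-linear n pre′ x y z post′ (suc c) x≡y-z))
                                  (distrib (e w c) _ _)
      where
      distrib : ∀ a b c → a * (b - c) ≡ a * b - a * c
      distrib = solve-∀
    above : alternatingSum (λ w rest → G w (rest ++ x ∷ post)) pre ≡ Py - Pz
    above = trans (alternatingSum-cong pre (λ w rest → G-linear w rest post)) (alternatingSum-difference _ _ pre)
    below : alternatingSum (λ w rest → G w (pre ++ x ∷ rest)) post ≡ Ty - Tz
    below = trans (alternatingSum-cong post (λ w rest → G-linear w pre rest)) (alternatingSum-difference _ _ post)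
    regroup : ∀ Py Pz s ey ez D Ty Tz → Py - Pz + s * ((ey - ez) * D - (Ty - Tz))
            ≡ (Py + s * (ey * D - Ty)) - (Pz + s * (ez * D - Tz))
    regroup = solve-∀

module _ {A B : Set} (e : A → ℕ → ℤ) (e′ : B → ℕ → ℤ) where

  det-pointwise : ∀ n {xs : List A} {ys : List B} c →
    Pointwise (λ x y → ∀ j → e x j ≡ e′ y j) xs ys → det e n xs c ≡ det e′ n ys c
  det-pointwise zero c [] = refl
  det-pointwise zero c (_ ∷ _) = refl
  det-pointwise (suc n) c xs∼ys =
    alternatingSum-pointwise _ xs∼ys (λ x∼y rest∼ → cong₂ _*_ (x∼y c) (det-pointwise n (suc c) rest∼))

upFrom : ℕ → ℕ → List ℕ
upFrom c zero = []
upFrom c (suc n) = c ∷ upFrom (suc c) n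

length-upFrom : ∀ c n → length (upFrom c n) ≡ n
length-upFrom c zero = refl
length-upFrom c (suc n) = cong suc (length-upFrom (suc c) n)

upFrom-snoc : ∀ c m → upFrom c (suc m) ≡ upFrom c m ++ [ c ℕ.+ m ]
upFrom-snoc c zero = cong [_] (sym (ℕ.+-identityʳ c))
upFrom-snoc c (suc m) = cong (c ∷_) (trans (upFrom-snoc (suc c) m) (cong (λ x → upFrom (suc c) m ++ [ x ]) (sym (ℕ.+-suc c m))))

upFrom-++ : ∀ c m m′ → upFrom c (m ℕ.+ m′) ≡ upFrom c m ++ upFrom (c ℕ.+ m) m′
upFrom-++ c zero m′ = cong (λ c′ → upFrom c′ m′) (sym (ℕ.+-identityʳ c))
upFrom-++ c (suc m) m′ = cong (c ∷_) (trans (upFrom-++ (suc c) m m′) (cong (λ c′ → upFrom (suc c) m ++ upFrom c′ m′) (sym (ℕ.+-suc c m))))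

upFrom-above : ∀ c n → All (c <_) (upFrom (suc c) n)
upFrom-above c zero = []
upFrom-above c (suc n) = ℕ.≤-refl ∷ All.map (ℕ.<-trans (ℕ.n<1+n c)) (upFrom-above (suc c) n)

range≡upFrom : ∀ k → range k ≡ upFrom 1 k
range≡upFrom k = shifted k id 0 (λ i → refl)
  where
  shifted : ∀ n (f : ℕ → ℕ) c → (∀ i → f i ≡ c ℕ.+ i) → map suc (applyUpTo f n) ≡ upFrom (suc c) n
  shifted zero f c f≗ = refl
  shifted (suc n) f c f≗ = cong₂ _∷_ (cong suc (trans (f≗ 0) (ℕ.+-identityʳ c)))
                                     (shifted n (f ∘′ suc) (suc c) (λ i → trans (f≗ (suc i)) (ℕ.+-suc c i)))

<ᵇ-true : ∀ {i a} → i < a → (i <ᵇ a) ≡ true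
<ᵇ-true i<a = Equivalence.to Bool.T-≡ (ℕ.<⇒<ᵇ i<a)

<ᵇ-false : ∀ {i a} → a ≤ i → (i <ᵇ a) ≡ false
<ᵇ-false {i} {a} a≤i = Bool.¬-not (λ eq → ℕ.≤⇒≯ a≤i (ℕ.<ᵇ⇒< i a (Equivalence.from Bool.T-≡ eq)))

≡ᵇ-false : ∀ {i a} → i ≢ a → (i ≡ᵇ a) ≡ false
≡ᵇ-false {i} {a} i≢a = Bool.¬-not (λ eq → i≢a (ℕ.≡ᵇ⇒≡ i a (Equivalence.from Bool.T-≡ eq)))

≡ᵇ-refl : ∀ i → (i ≡ᵇ i) ≡ true
≡ᵇ-refl i = Equivalence.to Bool.T-≡ (ℕ.≡⇒≡ᵇ i i refl)


countBelow : ℕ → List ℕ → ℕ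
countBelow y π = length (filterᵇ (_<ᵇ y) π)

sign-∷ : ∀ y π → sign (y ∷ π) ≡ sgn (countBelow y π) * sign π
sign-∷ y π = trans (sign≡sgn-inversions (y ∷ π))
  (trans (sgn-+ (countBelow y π) (inversions π)) (cong (sgn (countBelow y π) *_) (sym (sign≡sgn-inversions π))))

countBelow-∷ : ∀ y z π → countBelow y (z ∷ π) ≡ (if z <ᵇ y then suc (countBelow y π) else countBelow y π)
countBelow-∷ y z π rewrite filterᵇ-≗-if (_<ᵇ y) z π with z <ᵇ y
... | true = refl
... | false = refl

countBelow-least : ∀ c π → All (c <_) π → countBelow c π ≡ 0
countBelow-least c [] [] = refl
countBelow-least c (z ∷ π) (c<z ∷ c<π) rewrite countBelow-∷ c z π | <ᵇ-false (ℕ.<⇒≤ c<z) = countBelow-least c π c<π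

countBelow-insertAll : ∀ c y π → c < y → All (λ π′ → countBelow y π′ ≡ suc (countBelow y π)) (insertAll c π)
countBelow-insertAll c y π c<y = go π
  where
  in-front : ∀ π → countBelow y (c ∷ π) ≡ suc (countBelow y π)
  in-front π rewrite countBelow-∷ y c π | <ᵇ-true c<y = refl
  go : ∀ π → All (λ π′ → countBelow y π′ ≡ suc (countBelow y π)) (insertAll c π)
  go [] = in-front [] ∷ []
  go (z ∷ π) = in-front (z ∷ π) ∷ All.map⁺ (All.map (λ {π′} → behind π′) (go π))
    where
    behind : ∀ π′ → countBelow y π′ ≡ suc (countBelow y π) → countBelow y (z ∷ π′) ≡ suc (countBelow y (z ∷ π))
    behind π′ e rewrite countBelow-∷ y z π′ | countBelow-∷ y z π | e with z <ᵇ y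
    ... | true = refl
    ... | false = refl

insertAll-All : {P : ℕ → Set} → ∀ c π → P c → All P π → All (All P) (insertAll c π)
insertAll-All c [] pc [] = (pc ∷ []) ∷ []
insertAll-All c (z ∷ π) pc (pz ∷ pπ) = (pc ∷ pz ∷ pπ) ∷ All.map⁺ (All.map (pz ∷_) (insertAll-All c π pc pπ))

length-insertAll : ∀ c π → All (λ π′ → length π′ ≡ suc (length π)) (insertAll c π)
length-insertAll c [] = refl ∷ []
length-insertAll c (z ∷ π) = refl ∷ All.map⁺ (All.map (cong suc) (length-insertAll c π))

perms-All : {P : ℕ → Set} → ∀ l → All P l → All (All P) (perms l)
perms-All [] [] = [] ∷ []
perms-All (x ∷ l) (px ∷ pl) =
  All.concat⁺ (All.map⁺ (All.map (λ {π} → insertAll-All x π px) (perms-All l pl)))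

length-perms : ∀ l → All (λ π → length π ≡ length l) (perms l)
length-perms [] = refl ∷ []
length-perms (x ∷ l) = All.concat⁺ (All.map⁺ (All.map (λ {π} e → All.map (λ e′ → trans e′ (cong suc e)) (length-insertAll x π))
                                                       (length-perms l)))

permProduct : {A : Set} → (A → ℕ → ℤ) → List A → List ℕ → ℤ
permProduct e [] [] = + 1
permProduct e (x ∷ xs) (j ∷ π) = e x j * permProduct e xs π
permProduct e [] (_ ∷ _) = + 0
permProduct e (_ ∷ _) [] = + 0

module _ {A : Set} (e : A → ℕ → ℤ) where

  -- Inserting the least column c in position i multiplies the sign by (-1)^i.
  ∑-insertAll : ∀ c π (rows : List A) → All (c <_) π → length rows ≡ suc (length π) →
    ∑ (λ π′ → sign π′ * permProduct e rows π′) (insertAll c π)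
      ≡ alternatingSum (λ x rest → e x c * (sign π * permProduct e rest π)) rows
  ∑-insertAll c [] (x ∷ []) _ _ = unit (e x c)
    where
    unit : ∀ a → + 1 * (a * + 1) + + 0 ≡ a * (+ 1 * + 1) - + 0
    unit = solve-∀
  ∑-insertAll c (y ∷ π) (x ∷ rows) (c<y ∷ c<π) len = begin
      sign (c ∷ y ∷ π) * (e x c * permProduct e rows (y ∷ π))
        + ∑ (λ π′ → sign π′ * permProduct e (x ∷ rows) π′) (map (y ∷_) (insertAll c π))
    ≡⟨ cong₂ _+_ (cong (_* (e x c * permProduct e rows (y ∷ π))) sign-least-first) later-insertions ⟩
      sign (y ∷ π) * (e x c * permProduct e rows (y ∷ π)) + (- K) * alternatingSum h rows
    ≡⟨ regroup (sign (y ∷ π)) (e x c) (permProduct e rows (y ∷ π)) K (alternatingSum h rows) ⟩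
      e x c * (sign (y ∷ π) * permProduct e rows (y ∷ π)) - K * alternatingSum h rows
    ≡⟨ cong (_-_ (e x c * (sign (y ∷ π) * permProduct e rows (y ∷ π)))) (sym expanded-rest) ⟩
      alternatingSum (λ w rest → e w c * (sign (y ∷ π) * permProduct e rest (y ∷ π))) (x ∷ rows) ∎
    where
    open ≡-Reasoning
    K : ℤ
    K = sgn (countBelow y π) * e x y
    h : A → List A → ℤ
    h w rest = e w c * (sign π * permProduct e rest π)
    regroup : ∀ s a p k t → s * (a * p) + (- k) * t ≡ a * (s * p) - k * t
    regroup = solve-∀
    sign-least-first : sign (c ∷ y ∷ π) ≡ sign (y ∷ π)
    sign-least-first = trans (sign-∷ c (y ∷ π))
      (trans (cong (λ n → sgn n * sign (y ∷ π)) (countBelow-least c (y ∷ π) (c<y ∷ c<π))) (ℤ.*-identityˡ _))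
    later-insertions : ∑ (λ π′ → sign π′ * permProduct e (x ∷ rows) π′) (map (y ∷_) (insertAll c π))
                     ≡ (- K) * alternatingSum h rows
    later-insertions =
      trans (∑-map _ (y ∷_) (insertAll c π))
      (trans (∑-cong-All (insertAll c π) (countBelow-insertAll c y π c<y) (λ π′ e′ →
          trans (cong (_* (e x y * permProduct e rows π′)) (trans (sign-∷ y π′) (cong (λ n → sgn n * sign π′) e′)))
                (regroup′ (sgn (countBelow y π)) (sign π′) (e x y) (permProduct e rows π′))))
      (trans (∑-*ˡ (- K) (λ π′ → sign π′ * permProduct e rows π′) (insertAll c π))
        (cong ((- K) *_) (∑-insertAll c π rows c<π (ℕ.suc-injective len)))))
      where
      regroup′ : ∀ s t a p → (- s) * t * (a * p) ≡ (- (s * a)) * (t * p)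
      regroup′ = solve-∀
    expanded-rest : alternatingSum (λ w rest → e w c * (sign (y ∷ π) * permProduct e (x ∷ rest) (y ∷ π))) rows
                  ≡ K * alternatingSum h rows
    expanded-rest =
      trans (alternatingSum-cong rows (λ w rest →
          trans (cong (λ s → e w c * (s * (e x y * permProduct e rest π))) (sign-∷ y π))
                (regroup″ (e w c) (sgn (countBelow y π)) (sign π) (e x y) (permProduct e rest π))))
        (alternatingSum-*ˡ K h rows)
      where
      regroup″ : ∀ a s t b p → a * (s * t * (b * p)) ≡ s * b * (a * (t * p))
      regroup″ = solve-∀

  leibniz≡det : ∀ n c (rows : List A) → length rows ≡ n →
    ∑ (λ π → sign π * permProduct e rows π) (perms (upFrom c n)) ≡ det e n rows c
  leibniz≡det zero c [] len = refl
  leibniz≡det (suc n) c rows len =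
    trans (∑-concatMap (λ π → sign π * permProduct e rows π) (insertAll c) (perms (upFrom (suc c) n)))
    (trans (∑-cong-All (perms (upFrom (suc c) n))
                       (All.zip (perms-All (upFrom (suc c) n) (upFrom-above c n) , length-perms (upFrom (suc c) n)))
                       (λ π h → ∑-insertAll c π rows (proj₁ h)
                                  (trans len (cong suc (sym (trans (proj₂ h) (length-upFrom (suc c) n)))))))
    (trans (∑-alternatingSum (λ π y rest → e y c * (sign π * permProduct e rest π)) (perms (upFrom (suc c) n)) rows)
      (alternatingSum-cong-length n rows len (λ y rest len′ →
        trans (∑-*ˡ (e y c) (λ π → sign π * permProduct e rest π) (perms (upFrom (suc c) n)))
              (cong (e y c *_) (leibniz≡det n (suc c) rest len′))))))

-- Pdet as an average of determinants over Ω

sumℚ-divℚ : {A : Set} (N : ℕ) (X : A → ℤ) (xs : List A) →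
  sumℚ (map (λ a → divℚ (X a) N) xs) ≡ divℚ (∑ X xs) N
sumℚ-divℚ N X [] = sym (divℚ-0 N)
sumℚ-divℚ N X (x ∷ xs) = trans (cong (divℚ (X x) N ℚ.+_) (sumℚ-divℚ N X xs)) (sym (divℚ-+ N _ _))

value-rowsCap : {k r : ℕ} (M : ℕ → ℕ → GEvent k r) (i : ℕ) (π : List ℕ) (ω : Pt k r) →
  value (rowsCap M i π) ω ≡ permProduct (λ i j → value (M i j) ω) (upFrom i (length π)) π
value-rowsCap M i [] ω = refl
value-rowsCap M i (j ∷ π) ω =
  trans (value-∩ (M i j) (rowsCap M (suc i) π) ω) (cong (value (M i j) ω *_) (value-rowsCap M (suc i) π ω))

module _ (k r : ℕ) (p : Vec ℕ k) where

  ∣Ω∣ : ℕ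
  ∣Ω∣ = length (Ω k r p)

  detAt : (ℕ → ℕ → GEvent k r) → Pt k r → ℤ
  detAt M ω = det (λ i j → value (M i j) ω) k (upFrom 1 k) 1

  Pr≡∑value : (A : GEvent k r) → Pr k r p A ≡ divℚ (∑ (value A) (Ω k r p)) ∣Ω∣
  Pr≡∑value A = trans (by-terms A) (cong (λ z → divℚ z ∣Ω∣)
      (trans (∑-cong A (λ cE → sym (∑-*ˡ (proj₁ cE) (λ ω → ⟦ proj₂ cE ω ⟧) (Ω k r p))))
             (∑-comm (λ cE ω → proj₁ cE * ⟦ proj₂ cE ω ⟧) A (Ω k r p))))
    where
    by-terms : (A : GEvent k r) →
      Pr k r p A ≡ divℚ (∑ (λ cE → proj₁ cE * ∑ (λ ω → ⟦ proj₂ cE ω ⟧) (Ω k r p)) A) ∣Ω∣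
    by-terms [] = sym (divℚ-0 ∣Ω∣)
    by-terms ((c , E) ∷ A) =
      trans (cong₂ ℚ._+_ (trans (cong (λ z → divℚ c 1 ℚ.* divℚ z ∣Ω∣) (length-filterᵇ≡∑ E (Ω k r p)))
                                (divℚ-*-integer ∣Ω∣ c _))
                         (by-terms A))
            (sym (divℚ-+ ∣Ω∣ _ _))

  Pdet≡∑detAt : (M : ℕ → ℕ → GEvent k r) → Pdet k r p M ≡ divℚ (∑ (detAt M) (Ω k r p)) ∣Ω∣
  Pdet≡∑detAt M = begin
      foldr ℚ._+_ ℚ.0ℚ (map (λ π → divℚ (sign π) 1 ℚ.* Pr k r p (rowsCap M 1 π)) (perms (range k)))
    ≡⟨ cong (foldr ℚ._+_ ℚ.0ℚ) (List.map-cong term (perms (range k))) ⟩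
      sumℚ (map (λ π → divℚ (sign π * ∑ (value (rowsCap M 1 π)) (Ω k r p)) ∣Ω∣) (perms (range k)))
    ≡⟨ sumℚ-divℚ ∣Ω∣ _ (perms (range k)) ⟩
      divℚ (∑ (λ π → sign π * ∑ (value (rowsCap M 1 π)) (Ω k r p)) (perms (range k))) ∣Ω∣
    ≡⟨ cong (λ z → divℚ z ∣Ω∣) (trans (∑-cong (perms (range k)) (λ π → sym (∑-*ˡ (sign π) _ (Ω k r p))))
                                      (∑-comm (λ π ω → sign π * value (rowsCap M 1 π) ω) (perms (range k)) (Ω k r p))) ⟩
      divℚ (∑ (λ ω → ∑ (λ π → sign π * value (rowsCap M 1 π) ω) (perms (range k))) (Ω k r p)) ∣Ω∣
    ≡⟨ cong (λ z → divℚ z ∣Ω∣) (∑-cong (Ω k r p) leibniz-at) ⟩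
      divℚ (∑ (detAt M) (Ω k r p)) ∣Ω∣ ∎
    where
    open ≡-Reasoning
    term : ∀ π → divℚ (sign π) 1 ℚ.* Pr k r p (rowsCap M 1 π) ≡ divℚ (sign π * ∑ (value (rowsCap M 1 π)) (Ω k r p)) ∣Ω∣
    term π = trans (cong (divℚ (sign π) 1 ℚ.*_) (Pr≡∑value (rowsCap M 1 π))) (divℚ-*-integer ∣Ω∣ (sign π) _)
    leibniz-at : ∀ ω → ∑ (λ π → sign π * value (rowsCap M 1 π) ω) (perms (range k)) ≡ detAt M ω
    leibniz-at ω rewrite range≡upFrom k =
      trans (∑-cong-All (perms (upFrom 1 k)) (length-perms (upFrom 1 k)) (λ π len →
               cong (sign π *_) (trans (value-rowsCap M 1 π ω)
                 (cong (λ m → permProduct (λ i j → value (M i j) ω) (upFrom 1 m) π) (trans len (length-upFrom 1 k))))))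
            (leibniz≡det (λ i j → value (M i j) ω) k 1 (upFrom 1 k) (length-upFrom 1 k))

-- Swapping two adjacent values of f is a bijection of Ω

transposition : ℕ → ℕ → ℕ
transposition zero zero = 1
transposition zero (suc zero) = 0
transposition zero (suc (suc s)) = suc (suc s)
transposition (suc q) zero = zero
transposition (suc q) (suc s) = suc (transposition q s)

transposition-q : ∀ q → transposition q q ≡ suc q
transposition-q zero = refl
transposition-q (suc q) = cong suc (transposition-q q)

transposition-suc-q : ∀ q → transposition q (suc q) ≡ q
transposition-suc-q zero = refl
transposition-suc-q (suc q) = cong suc (transposition-suc-q q)

transposition-below : ∀ q s → s < q → transposition q s ≡ s
transposition-below (suc q) zero s<q = refl
transposition-below (suc q) (suc s) (s≤s s<q) = cong suc (transposition-below q s s<q)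

transposition-above : ∀ q s → suc q < s → transposition q s ≡ s
transposition-above zero (suc zero) (s≤s ())
transposition-above zero (suc (suc s)) _ = refl
transposition-above (suc q) (suc s) (s≤s q<s) = cong suc (transposition-above q s q<s)

-- Swapping the entries at the (1-based) positions q and q + 1 of a vector

swapAt : {A : Set} {n : ℕ} → ℕ → Vec A n → Vec A n
swapAt zero v = v
swapAt (suc q) [] = []
swapAt (suc zero) (x ∷ []) = x ∷ []
swapAt (suc zero) (x ∷ y ∷ v) = y ∷ x ∷ v
swapAt (suc (suc q)) (x ∷ v) = x ∷ swapAt (suc q) v

module _ {A : Set} where

  get-swapAt : {n : ℕ} (d : A) (q : ℕ) (v : Vec A n) → 1 ≤ q → suc q ≤ n →
    ∀ s → get d (swapAt q v) s ≡ get d v (transposition q s)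
  get-swapAt d (suc zero) (x ∷ []) _ (s≤s ()) s
  get-swapAt d (suc zero) (x ∷ y ∷ v) _ _ zero = refl
  get-swapAt d (suc zero) (x ∷ y ∷ v) _ _ (suc zero) = refl
  get-swapAt d (suc zero) (x ∷ y ∷ v) _ _ (suc (suc zero)) = refl
  get-swapAt d (suc zero) (x ∷ y ∷ v) _ _ (suc (suc (suc s))) = refl
  get-swapAt d (suc (suc q)) (x ∷ v) _ (s≤s q<n) zero = refl
  get-swapAt d (suc (suc q)) (x ∷ v) _ (s≤s q<n) (suc zero) = refl
  get-swapAt d (suc (suc q)) (x ∷ v) _ (s≤s q<n) (suc (suc s)) = get-swapAt d (suc q) v (s≤s z≤n) q<n (suc s)

  map-get-range : {n : ℕ} (d : A) (v : Vec A n) → map (get d v) (range n) ≡ toList v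
  map-get-range {n} d v = trans (cong (map (get d v)) (range≡upFrom n)) (from-one d v)
    where
    shift : ∀ {n} (d x : A) (v : Vec A n) c m →
      map (get d (x ∷ v)) (upFrom (suc (suc c)) m) ≡ map (get d v) (upFrom (suc c) m)
    shift d x v c zero = refl
    shift d x v c (suc m) = cong (get d v (suc c) ∷_) (shift d x v (suc c) m)
    from-one : ∀ {n} (d : A) (v : Vec A n) → map (get d v) (upFrom 1 n) ≡ toList v
    from-one d [] = refl
    from-one d (x ∷ v) = cong (x ∷_) (trans (shift d x v 0 _) (from-one d v))

  any-swapAt : {n : ℕ} (P : A → Bool) (q : ℕ) (v : Vec A n) → any P (toList (swapAt q v)) ≡ any P (toList v)
  any-swapAt P (suc zero) (x ∷ y ∷ v) =
    trans (sym (Bool.∨-assoc (P y) (P x) _))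
          (trans (cong (_∨ any P (toList v)) (Bool.∨-comm (P y) (P x))) (Bool.∨-assoc (P x) (P y) _))
  any-swapAt P (suc zero) [] = refl
  any-swapAt P (suc zero) (x ∷ []) = refl
  any-swapAt P (suc (suc q)) [] = refl
  any-swapAt P (suc (suc q)) (x ∷ v) = cong (P x ∨_) (any-swapAt P (suc q) v)
  any-swapAt P zero v = refl

isSurj-swapAt : ∀ k r q (f : Fun k) → isSurj k r (swapAt q f) ≡ isSurj k r f
isSurj-swapAt k r q f = cong and (List.map-cong hits (range r))
  where
  via-entries : ∀ t (g : Fun k) → any (λ i → app {k} g i ≡ᵇ t) (range (k ∸ 1)) ≡ any (_≡ᵇ t) (toList g)
  via-entries t g = cong or (trans (List.map-∘ (range (k ∸ 1))) (cong (map (_≡ᵇ t)) (map-get-range 0 g)))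
  hits : ∀ t → any (λ i → app {k} (swapAt q f) i ≡ᵇ t) (range (k ∸ 1)) ≡ any (λ i → app {k} f i ≡ᵇ t) (range (k ∸ 1))
  hits t = trans (via-entries t (swapAt q f)) (trans (any-swapAt (_≡ᵇ t) q f) (sym (via-entries t f)))

module _ {A : Set} (xs : List A) where

  ∑-allVec-∷ : ∀ n (G : Vec A (suc n) → ℤ) →
    ∑ G (allVec xs (suc n)) ≡ ∑ (λ x → ∑ (λ v → G (x ∷ v)) (allVec xs n)) xs
  ∑-allVec-∷ n G = trans (∑-concatMap G _ xs) (∑-cong xs (λ x → ∑-map G (x ∷_) (allVec xs n)))

  ∑-allVec-swapAt : ∀ n q (G : Vec A n → ℤ) → ∑ G (allVec xs n) ≡ ∑ (G ∘ swapAt q) (allVec xs n)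
  ∑-allVec-swapAt n zero G = refl
  ∑-allVec-swapAt zero (suc q) G = refl
  ∑-allVec-swapAt (suc zero) (suc zero) G = trans (∑-allVec-∷ 0 G) (sym (∑-allVec-∷ 0 (G ∘ swapAt 1)))
  ∑-allVec-swapAt (suc (suc n)) (suc zero) G =
    trans (∑-allVec-∷ (suc n) G)
    (trans (∑-cong xs (λ x → ∑-allVec-∷ n (λ v → G (x ∷ v))))
    (trans (∑-comm (λ x y → ∑ (λ w → G (x ∷ y ∷ w)) (allVec xs n)) xs xs)
      (sym (trans (∑-allVec-∷ (suc n) (G ∘ swapAt 1))
                  (∑-cong xs (λ x → ∑-allVec-∷ n (λ v → G (swapAt 1 (x ∷ v)))))))))
  ∑-allVec-swapAt (suc n) (suc (suc q)) G =
    trans (∑-allVec-∷ n G)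
    (trans (∑-cong xs (λ x → ∑-allVec-swapAt n (suc q) (λ v → G (x ∷ v))))
      (sym (∑-allVec-∷ n (G ∘ swapAt (suc (suc q))))))

∑Ω-swapAt : ∀ k r p q (F : Pt k r → ℤ) →
  ∑ F (Ω k r p) ≡ ∑ (λ ω → F (proj₁ ω , swapAt q (proj₂ ω))) (Ω k r p)
∑Ω-swapAt k r p q F =
  trans (∑-filterᵇ _ F candidates)
  (trans (∑-concatMap _ _ tuples)
  (trans (∑-cong tuples (λ S → ∑-map _ _ funs))
  (trans (∑-cong tuples (λ S → trans (∑-allVec-swapAt (range r) (k ∸ 1) q _)
            (∑-cong funs (λ f → cong (λ b → ⟦ inSpr k r p S ∧ b ⟧ * F (S , swapAt q f)) (isSurj-swapAt k r q f)))))
  (sym (trans (∑-filterᵇ _ _ candidates)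
       (trans (∑-concatMap _ _ tuples)
         (∑-cong tuples (λ S → ∑-map _ _ funs))))))))
  where
  tuples = allVec (allVec (true ∷ false ∷ []) k) r
  funs = allVec (range r) (k ∸ 1)
  candidates = concatMap (λ S → map (S ,_) funs) tuples

-- Rows of event matrices, as functions of the column j:
-- J i s is j ↦ J^{f(s)}_{i,j+1}, J⊖J i i′ s is j ↦ J^{f(s)}_{i,j+1} − J^{f(s)}_{i′,j+1}, and full is j ↦ Ω.
data Row : Set where
  J : (i s : ℕ) → Row
  J⊖J : (i i′ s : ℕ) → Row
  full : Row

relabel : ℕ → Row → Row
relabel q (J i s) = J i (transposition q s)
relabel q (J⊖J i i′ s) = J⊖J i i′ (transposition q s)
relabel q full = full

LabelIn : (ℕ → Set) → Row → Set
LabelIn P (J i s) = P s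
LabelIn P (J⊖J i i′ s) = P s
LabelIn P full = ⊤

LabelIn-map : {P Q : ℕ → Set} → (∀ {s} → P s → Q s) → ∀ {row} → LabelIn P row → LabelIn Q row
LabelIn-map P⇒Q {J i s} = P⇒Q
LabelIn-map P⇒Q {J⊖J i i′ s} = P⇒Q
LabelIn-map P⇒Q {full} = λ _ → tt

map-relabel-fixed : ∀ q rows → All (LabelIn (λ s → transposition q s ≡ s)) rows → map (relabel q) rows ≡ rows
map-relabel-fixed q [] [] = refl
map-relabel-fixed q (J i s ∷ rows) (fixed ∷ fixeds) = cong₂ _∷_ (cong (J i) fixed) (map-relabel-fixed q rows fixeds)
map-relabel-fixed q (J⊖J i i′ s ∷ rows) (fixed ∷ fixeds) = cong₂ _∷_ (cong (J⊖J i i′) fixed) (map-relabel-fixed q rows fixeds)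
map-relabel-fixed q (full ∷ rows) (_ ∷ fixeds) = cong (full ∷_) (map-relabel-fixed q rows fixeds)

map-relabel-below : ∀ q rows → All (LabelIn (_< q)) rows → map (relabel q) rows ≡ rows
map-relabel-below q rows below = map-relabel-fixed q rows (All.map (λ {row} → LabelIn-map (λ {s} → transposition-below q s) {row}) below)

map-relabel-above : ∀ q rows → All (LabelIn (suc q <_)) rows → map (relabel q) rows ≡ rows
map-relabel-above q rows above = map-relabel-fixed q rows (All.map (λ {row} → LabelIn-map (λ {s} → transposition-above q s) {row}) above)

J0≡Jk : ∀ k St j → JS k St 0 j ≡ JS k St k j
J0≡Jk zero St j = refl
J0≡Jk (suc n) St j = cong JS-from (sym (ℕ.n%n≡0 (suc n)))
  where
  -- JS depends on its interval start i only through i mod k, abstracted here as m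
  JS-from : ℕ → Bool
  JS-from m =
    if m ≡ᵇ modk (suc n) j
    then all (λ x → x ∈S St) (range (suc n))
    else all (λ x → not ((1 ≤ᵇ modk (suc n) (modk (suc n) x ℕ.+ suc n ∸ m))
                         ∧ (modk (suc n) (modk (suc n) x ℕ.+ suc n ∸ m) ≤ᵇ modk (suc n) (modk (suc n) j ℕ.+ suc n ∸ m)))
                    ∨ (x ∈S St)) (range (suc n))

Js : ℕ → List ℕ → List Row
Js q [] = []
Js q (i ∷ is) = J i q ∷ Js (suc q) is

Js-++ : ∀ q is is′ → Js q (is ++ is′) ≡ Js q is ++ Js (q ℕ.+ length is) is′
Js-++ q [] is′ = cong (λ q′ → Js q′ is′) (sym (ℕ.+-identityʳ q))
Js-++ q (i ∷ is) is′ =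
  cong (J i q ∷_) (trans (Js-++ (suc q) is is′) (cong (λ q′ → Js (suc q) is ++ Js q′ is′) (sym (ℕ.+-suc q (length is)))))

length-Js : ∀ q is → length (Js q is) ≡ length is
length-Js q [] = refl
length-Js q (i ∷ is) = cong suc (length-Js (suc q) is)

Js-above : ∀ q is → All (LabelIn (q <_)) (Js (suc q) is)
Js-above q [] = []
Js-above q (i ∷ is) =
  ℕ.n<1+n q ∷ All.map (λ {row} → LabelIn-map (ℕ.<-trans (ℕ.n<1+n q)) {row}) (Js-above (suc q) is)

Js-below : ∀ q is → All (LabelIn (_< q ℕ.+ length is)) (Js q is)
Js-below q [] = []
Js-below q (i ∷ is) =
  subst (q <_) (sym (ℕ.+-suc q (length is))) (s≤s (ℕ.m≤m+n q (length is)))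
  ∷ subst (λ b → All (LabelIn (_< b)) (Js (suc q) is)) (sym (ℕ.+-suc q (length is))) (Js-below (suc q) is)

differences : ℕ → ℕ → List Row
differences c m = map (λ i → J⊖J i (i ∸ 1) i) (upFrom c m)

differences-above : ∀ q m → All (LabelIn (q <_)) (differences (suc q) m)
differences-above q zero = []
differences-above q (suc m) =
  ℕ.n<1+n q ∷ All.map (λ {row} → LabelIn-map (ℕ.<-trans (ℕ.n<1+n q)) {row}) (differences-above (suc q) m)

module Rows (k r : ℕ) (p : Vec ℕ k) where

  entry : Pt k r → Row → ℕ → ℤ
  entry ω (J i s) j = ⟦ Jf k r s i (suc j) ω ⟧
  entry ω (J⊖J i i′ s) j = ⟦ Jf k r s i (suc j) ω ⟧ - ⟦ Jf k r s i′ (suc j) ω ⟧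
  entry ω full j = + 1

  ∑det : List Row → ℤ
  ∑det rows = ∑ (λ ω → det (entry ω) k rows 1) (Ω k r p)

  SameEntries : Row → Row → Set
  SameEntries a b = ∀ ω j → entry ω a j ≡ entry ω b j

  ∑det-pointwise : ∀ {as bs} → Pointwise SameEntries as bs → ∑det as ≡ ∑det bs
  ∑det-pointwise as≈bs = ∑-cong (Ω k r p) (λ ω →
    det-pointwise (entry ω) (entry ω) k 1 (Pointwise.map (λ a≈b → a≈b ω) as≈bs))

  ∑det-swap : ∀ pre a b post → ∑det (pre ++ a ∷ b ∷ post) ≡ - ∑det (pre ++ b ∷ a ∷ post)
  ∑det-swap pre a b post =
    trans (∑-cong (Ω k r p) (λ ω → det-swap (entry ω) k pre a b post 1)) (∑-neg _ (Ω k r p))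

  ∑det-J⊖J : ∀ pre i i′ s post →
    ∑det (pre ++ J⊖J i i′ s ∷ post) ≡ ∑det (pre ++ J i s ∷ post) - ∑det (pre ++ J i′ s ∷ post)
  ∑det-J⊖J pre i i′ s post =
    trans (∑-cong (Ω k r p) (λ ω → det-linear (entry ω) k pre (J⊖J i i′ s) (J i s) (J i′ s) post 1 (λ j → refl)))
    (trans (∑-+ _ _ (Ω k r p)) (cong (_+_ (∑det (pre ++ J i s ∷ post))) (∑-neg _ (Ω k r p))))

  ∑det-relabel : ∀ q → 1 ≤ q → suc q ≤ k ∸ 1 → ∀ rows → ∑det (map (relabel q) rows) ≡ ∑det rows
  ∑det-relabel q 1≤q q<k-1 rows = sym (trans (∑Ω-swapAt k r p q (λ ω → det (entry ω) k rows 1))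
    (∑-cong (Ω k r p) (λ ω → det-pointwise _ _ k 1 (entries-relabel ω rows))))
    where
    entry-relabel : ∀ ω row j → entry (proj₁ ω , swapAt q (proj₂ ω)) row j ≡ entry ω (relabel q row) j
    entry-relabel ω (J i s) j =
      cong (λ t → ⟦ JS k (comp (proj₁ ω) t) i (suc j) ⟧) (get-swapAt 0 q (proj₂ ω) 1≤q q<k-1 s)
    entry-relabel ω (J⊖J i i′ s) j =
      cong (λ t → ⟦ JS k (comp (proj₁ ω) t) i (suc j) ⟧ - ⟦ JS k (comp (proj₁ ω) t) i′ (suc j) ⟧)
           (get-swapAt 0 q (proj₂ ω) 1≤q q<k-1 s)
    entry-relabel ω full j = refl
    entries-relabel : ∀ ω rows → Pointwise (λ a b → ∀ j → entry (proj₁ ω , swapAt q (proj₂ ω)) a j ≡ entry ω b j)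
                                           rows (map (relabel q) rows)
    entries-relabel ω [] = []
    entries-relabel ω (row ∷ rows) = entry-relabel ω row ∷ entries-relabel ω rows

  -- Relabelling by the transposition of q and q + 1 preserves ∑det and fixes pre and post.
  ∑det-exchange : ∀ q pre a b post → 1 ≤ q → suc q ≤ k ∸ 1 →
    All (LabelIn (_< q)) pre → All (LabelIn (suc q <_)) post →
    ∑det (pre ++ a ∷ b ∷ post) ≡ - ∑det (pre ++ relabel q b ∷ relabel q a ∷ post)
  ∑det-exchange q pre a b post 1≤q q<k-1 below above = begin
      ∑det (pre ++ a ∷ b ∷ post)                          ≡⟨ sym (∑det-relabel q 1≤q q<k-1 (pre ++ a ∷ b ∷ post)) ⟩
      ∑det (map (relabel q) (pre ++ a ∷ b ∷ post))        ≡⟨ cong ∑det relabelled ⟩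
      ∑det (pre ++ relabel q a ∷ relabel q b ∷ post)      ≡⟨ ∑det-swap pre (relabel q a) (relabel q b) post ⟩
      - ∑det (pre ++ relabel q b ∷ relabel q a ∷ post)    ∎
    where
    open ≡-Reasoning
    relabelled : map (relabel q) (pre ++ a ∷ b ∷ post) ≡ pre ++ relabel q a ∷ relabel q b ∷ post
    relabelled = trans (List.map-++ (relabel q) pre (a ∷ b ∷ post))
      (cong₂ _++_ (map-relabel-below q pre below)
                  (cong (λ rest → relabel q a ∷ relabel q b ∷ rest) (map-relabel-above q post above)))

  ∑det-J-consecutive : ∀ q i pre post → 1 ≤ q → suc q ≤ k ∸ 1 →
    All (LabelIn (_< q)) pre → All (LabelIn (suc q <_)) post →
    ∑det (pre ++ J i q ∷ J i (suc q) ∷ post) ≡ + 0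
  ∑det-J-consecutive q i pre post 1≤q q<k-1 below above =
    self-negating (trans (∑det-exchange q pre (J i q) (J i (suc q)) post 1≤q q<k-1 below above)
      (cong₂ (λ s t → - ∑det (pre ++ J i s ∷ J i t ∷ post)) (transposition-suc-q q) (transposition-q q)))
    where
    self-negating : ∀ {x} → x ≡ - x → x ≡ + 0
    self-negating {+ zero} _ = refl
    self-negating {+ suc n} ()
    self-negating { -[1+ n ]} ()

  ∑det-move : ∀ ys pre z post → ∑det (pre ++ ys ++ z ∷ post) ≡ sgn (length ys) * ∑det (pre ++ z ∷ ys ++ post)
  ∑det-move [] pre z post = sym (ℤ.*-identityˡ _)
  ∑det-move (y ∷ ys) pre z post = begin
      ∑det (pre ++ y ∷ ys ++ z ∷ post)                          ≡⟨ cong ∑det (sym (List.++-assoc pre [ y ] _)) ⟩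
      ∑det ((pre ++ [ y ]) ++ ys ++ z ∷ post)                   ≡⟨ ∑det-move ys (pre ++ [ y ]) z post ⟩
      sgn (length ys) * ∑det ((pre ++ [ y ]) ++ z ∷ ys ++ post) ≡⟨ cong (λ l → sgn (length ys) * ∑det l) (List.++-assoc pre [ y ] _) ⟩
      sgn (length ys) * ∑det (pre ++ y ∷ z ∷ ys ++ post)        ≡⟨ cong (sgn (length ys) *_) (∑det-swap pre y z (ys ++ post)) ⟩
      sgn (length ys) * - ∑det (pre ++ z ∷ y ∷ ys ++ post)      ≡⟨ sym (ℤ.neg-distribʳ-* (sgn (length ys)) _) ⟩
      - (sgn (length ys) * ∑det (pre ++ z ∷ y ∷ ys ++ post))    ≡⟨ ℤ.neg-distribˡ-* (sgn (length ys)) _ ⟩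
      sgn (length (y ∷ ys)) * ∑det (pre ++ z ∷ y ∷ ys ++ post)  ∎
    where open ≡-Reasoning

  ∑det-J0≡Jk : ∀ pre s post → ∑det (pre ++ J 0 s ∷ post) ≡ ∑det (pre ++ J k s ∷ post)
  ∑det-J0≡Jk pre s post = ∑det-pointwise (Pointwise.++⁺ (Pointwise.refl (λ ω j → refl))
                                           (0≈k ∷ Pointwise.refl (λ ω j → refl)))
    where
    0≈k : SameEntries (J 0 s) (J k s)
    0≈k ω j = cong ⟦_⟧ (J0≡Jk k (comp (proj₁ ω) (app {k} (proj₂ ω) s)) (suc j))

  ∑det-bubble : ∀ i is pre post q → 1 ≤ q → q ℕ.+ length is ≤ k ∸ 1 →
    All (LabelIn (_< q)) pre → All (LabelIn (q ℕ.+ length is <_)) post →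
    ∑det (pre ++ J i q ∷ Js (suc q) is ++ post) ≡ sgn (length is) * ∑det (pre ++ Js q is ++ J i (q ℕ.+ length is) ∷ post)
  ∑det-bubble i [] pre post q _ _ _ _ =
    sym (trans (ℤ.*-identityˡ _) (cong (λ s → ∑det (pre ++ J i s ∷ post)) (ℕ.+-identityʳ q)))
  ∑det-bubble i (x ∷ is) pre post q 1≤q bound below above = begin
      ∑det (pre ++ J i q ∷ J x (suc q) ∷ Js (suc (suc q)) is ++ post)
    ≡⟨ ∑det-exchange q pre (J i q) (J x (suc q)) _ 1≤q (ℕ.≤-trans q+1≤ bound) below
                     (All.++⁺ (Js-above (suc q) is) (All.map (λ {row} → LabelIn-map (ℕ.≤-<-trans q+1≤) {row}) above)) ⟩
      - ∑det (pre ++ J x (transposition q (suc q)) ∷ J i (transposition q q) ∷ Js (suc (suc q)) is ++ post)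
    ≡⟨ cong₂ (λ s t → - ∑det (pre ++ J x s ∷ J i t ∷ Js (suc (suc q)) is ++ post)) (transposition-suc-q q) (transposition-q q) ⟩
      - ∑det (pre ++ J x q ∷ J i (suc q) ∷ Js (suc (suc q)) is ++ post)
    ≡⟨ cong (λ l → - ∑det l) (sym (List.++-assoc pre [ J x q ] _)) ⟩
      - ∑det ((pre ++ [ J x q ]) ++ J i (suc q) ∷ Js (suc (suc q)) is ++ post)
    ≡⟨ cong -_ (∑det-bubble i is (pre ++ [ J x q ]) post (suc q) (s≤s z≤n) (subst (_≤ k ∸ 1) shift bound) below′
                            (subst (λ s → All (LabelIn (s <_)) post) shift above)) ⟩
      - (sgn (length is) * ∑det ((pre ++ [ J x q ]) ++ Js (suc q) is ++ J i (suc q ℕ.+ length is) ∷ post))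
    ≡⟨ ℤ.neg-distribˡ-* (sgn (length is)) _ ⟩
      sgn (length (x ∷ is)) * ∑det ((pre ++ [ J x q ]) ++ Js (suc q) is ++ J i (suc q ℕ.+ length is) ∷ post)
    ≡⟨ cong (λ l → sgn (length (x ∷ is)) * ∑det l) (List.++-assoc pre [ J x q ] _) ⟩
      sgn (length (x ∷ is)) * ∑det (pre ++ J x q ∷ Js (suc q) is ++ J i (suc q ℕ.+ length is) ∷ post)
    ≡⟨ cong (λ s → sgn (length (x ∷ is)) * ∑det (pre ++ J x q ∷ Js (suc q) is ++ J i s ∷ post)) (sym shift) ⟩
      sgn (length (x ∷ is)) * ∑det (pre ++ Js q (x ∷ is) ++ J i (q ℕ.+ length (x ∷ is)) ∷ post) ∎
    where
    open ≡-Reasoning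
    shift : q ℕ.+ suc (length is) ≡ suc q ℕ.+ length is
    shift = ℕ.+-suc q (length is)
    q+1≤ : suc q ≤ q ℕ.+ suc (length is)
    q+1≤ = subst (suc q ≤_) (sym shift) (s≤s (ℕ.m≤m+n q (length is)))
    below′ : All (LabelIn (_< suc q)) (pre ++ [ J x q ])
    below′ = All.++⁺ (All.map (λ {row} → LabelIn-map (λ s<q → ℕ.<-trans s<q (ℕ.n<1+n q)) {row}) below) (ℕ.n<1+n q ∷ [])

pointwise-upFrom : {B : Set} {R : ℕ → B → Set} (f : ℕ → B) (c m : ℕ) →
  (∀ i → c ≤ i → i < c ℕ.+ m → R i (f i)) → Pointwise R (upFrom c m) (map f (upFrom c m))
pointwise-upFrom f c zero R-f = []
pointwise-upFrom f c (suc m) R-f =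
  R-f c ℕ.≤-refl (ℕ.m<m+n c (s≤s z≤n))
  ∷ pointwise-upFrom f (suc c) m (λ i c<i i<c+1+m → R-f i (ℕ.<⇒≤ c<i) (subst (i <_) (sym (ℕ.+-suc c m)) i<c+1+m))

map-diagonal : ∀ c m → map (λ i → J i i) (upFrom c m) ≡ Js c (upFrom c m)
map-diagonal c zero = refl
map-diagonal c (suc m) = cong (J c c ∷_) (map-diagonal (suc c) m)

map-subdiagonal : ∀ c m → map (λ i → J i (i ∸ 1)) (upFrom (suc c) m) ≡ Js c (upFrom (suc c) m)
map-subdiagonal c zero = refl
map-subdiagonal c (suc m) = cong (J (suc c) c ∷_) (map-subdiagonal (suc c) m)

module _ (k r : ℕ) where

  Mγ-below : ∀ i j → i < k → Mγ k r i j ≡ ev (Jf k r i i (suc j)) ⊖ ev (Jf k r i (i ∸ 1) (suc j))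
  Mγ-below i j i<k rewrite <ᵇ-true i<k = refl

  Mγ-last : ∀ j → Mγ k r k j ≡ ΩE
  Mγ-last j rewrite <ᵇ-false {k} ℕ.≤-refl = refl

  Qa-below : ∀ a i j → i < a → Qa k r a i j ≡ ev (Jf k r i i (suc j))
  Qa-below a i j i<a rewrite <ᵇ-true i<a = refl

  Qa-at : ∀ a j → Qa k r a a j ≡ ΩE
  Qa-at a j rewrite <ᵇ-false {a} ℕ.≤-refl | ≡ᵇ-refl a = refl

  Qa-above : ∀ a i j → a < i → Qa k r a i j ≡ ev (Jf k r (i ∸ 1) i (suc j))
  Qa-above a i j a<i rewrite <ᵇ-false (ℕ.<⇒≤ a<i) | ≡ᵇ-false (ℕ.>⇒≢ a<i) = refl

module Telescoping (n r : ℕ) (p : Vec ℕ (suc n)) where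

  open Rows (suc n) r p

  RowOf : (ℕ → ℕ → GEvent (suc n) r) → Pt (suc n) r → ℕ → Row → Set
  RowOf M ω i row = ∀ j → value (M i j) ω ≡ entry ω row j

  Represents : (ℕ → ℕ → GEvent (suc n) r) → List Row → Set
  Represents M rows = ∀ ω → Pointwise (RowOf M ω) (upFrom 1 (suc n)) rows

  ∑detAt≡∑det : ∀ M rows → Represents M rows → ∑ (detAt (suc n) r p M) (Ω (suc n) r p) ≡ ∑det rows
  ∑detAt≡∑det M rows represents = ∑-cong (Ω (suc n) r p) (λ ω → det-pointwise _ _ (suc n) 1 (represents ω))

  Mγ-represented : Represents (Mγ (suc n) r) (differences 1 n ++ [ full ])
  Mγ-represented ω rewrite upFrom-snoc 1 n = Pointwise.++⁺
    (pointwise-upFrom {R = RowOf (Mγ (suc n) r) ω} _ 1 n (λ i _ i<k j →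
      trans (cong (λ A → value A ω) (Mγ-below (suc n) r i j i<k))
      (trans (value-⊖ (ev (Jf (suc n) r i i (suc j))) (ev (Jf (suc n) r i (i ∸ 1) (suc j))) ω)
             (cong₂ _-_ (value-ev (Jf (suc n) r i i (suc j)) ω) (value-ev (Jf (suc n) r i (i ∸ 1) (suc j)) ω)))))
    ((λ j → cong (λ A → value A ω) (Mγ-last (suc n) r j)) ∷ [])

  -- the rows of Q^{(a)} for a = a₀ + 1 and d = k − a: J 1 1, …, J a₀ a₀, Ω, J (a + 1) a, …, J k (k − 1)
  diagonal : ℕ → List Row
  diagonal a₀ = Js 1 (upFrom 1 a₀)

  subdiagonal : ℕ → ℕ → List Row
  subdiagonal a₀ d = Js (suc a₀) (upFrom (suc (suc a₀)) d)

  Qrows : ℕ → ℕ → List Row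
  Qrows a₀ d = diagonal a₀ ++ full ∷ subdiagonal a₀ d

  Qa-represented : ∀ a₀ → a₀ ≤ n → Represents (Qa (suc n) r (suc a₀)) (Qrows a₀ (n ∸ a₀))
  Qa-represented a₀ a₀≤n ω = subst (λ is → Pointwise (RowOf Q ω) is (Qrows a₀ (n ∸ a₀))) (sym split) (Pointwise.++⁺
    (subst (Pointwise (RowOf Q ω) (upFrom 1 a₀)) (map-diagonal 1 a₀)
      (pointwise-upFrom {R = RowOf Q ω} _ 1 a₀ (λ i _ i<a j →
        trans (cong (λ A → value A ω) (Qa-below (suc n) r (suc a₀) i j i<a)) (value-ev (Jf (suc n) r i i (suc j)) ω))))
    ((λ j → cong (λ A → value A ω) (Qa-at (suc n) r (suc a₀) j))
     ∷ subst (Pointwise (RowOf Q ω) (upFrom (suc (suc a₀)) (n ∸ a₀))) (map-subdiagonal (suc a₀) (n ∸ a₀))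
         (pointwise-upFrom {R = RowOf Q ω} _ (suc (suc a₀)) (n ∸ a₀) (λ i a<i _ j →
           trans (cong (λ A → value A ω) (Qa-above (suc n) r (suc a₀) i j a<i))
                 (value-ev (Jf (suc n) r (i ∸ 1) i (suc j)) ω)))))
    where
    Q : ℕ → ℕ → GEvent (suc n) r
    Q = Qa (suc n) r (suc a₀)
    split : upFrom 1 (suc n) ≡ upFrom 1 a₀ ++ upFrom (suc a₀) (suc (n ∸ a₀))
    split = trans (cong (upFrom 1) (sym (trans (ℕ.+-suc a₀ (n ∸ a₀)) (cong suc (ℕ.m+[n∸m]≡n a₀≤n)))))
                  (upFrom-++ 1 a₀ (suc (n ∸ a₀)))

  shifted : ℕ → List Row
  shifted m = Js 1 (upFrom 0 m)

  shifted-below : ∀ m → All (LabelIn (_< suc m)) (shifted m)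
  shifted-below m = subst (λ b → All (LabelIn (_< b)) (shifted m)) (cong suc (length-upFrom 0 m)) (Js-below 1 (upFrom 0 m))

  shifted-snoc : ∀ m → shifted (suc m) ≡ shifted m ++ [ J m (suc m) ]
  shifted-snoc m = trans (cong (Js 1) (upFrom-snoc 0 m))
    (trans (Js-++ 1 (upFrom 0 m) [ m ]) (cong (λ q → shifted m ++ [ J m q ]) (cong suc (length-upFrom 0 m))))

  mixed collapsed : ℕ → ℕ → List Row
  mixed m d = shifted m ++ differences (suc m) d ++ [ full ]
  collapsed m d = shifted m ++ Js (suc m) (upFrom (suc m) d) ++ [ full ]

  -- Each difference row J⊖J (i + 1) i (i + 1) loses its second term, which sits right below J i i with the same
  -- interval start and the consecutive label.
  ∑det-differences : ∀ d q pre → 1 ≤ q → q ℕ.+ d ≤ n → All (LabelIn (_< q)) pre →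
    ∑det (pre ++ J q q ∷ differences (suc q) d ++ [ full ]) ≡ ∑det (pre ++ J q q ∷ Js (suc q) (upFrom (suc q) d) ++ [ full ])
  ∑det-differences zero q pre _ _ _ = refl
  ∑det-differences (suc d) q pre 1≤q bound below = begin
      ∑det (pre ++ J q q ∷ J⊖J (suc q) q (suc q) ∷ rest)
    ≡⟨ cong ∑det (sym (List.++-assoc pre [ J q q ] _)) ⟩
      ∑det (pre′ ++ J⊖J (suc q) q (suc q) ∷ rest)
    ≡⟨ ∑det-J⊖J pre′ (suc q) q (suc q) rest ⟩
      ∑det (pre′ ++ J (suc q) (suc q) ∷ rest) - ∑det (pre′ ++ J q (suc q) ∷ rest)
    ≡⟨ cong₂ _-_ (∑det-differences d (suc q) pre′ (s≤s z≤n) (subst (_≤ n) (ℕ.+-suc q d) bound) below′) vanishes ⟩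
      ∑det (pre′ ++ J (suc q) (suc q) ∷ Js (suc (suc q)) (upFrom (suc (suc q)) d) ++ [ full ]) - + 0
    ≡⟨ ℤ.+-identityʳ _ ⟩
      ∑det (pre′ ++ J (suc q) (suc q) ∷ Js (suc (suc q)) (upFrom (suc (suc q)) d) ++ [ full ])
    ≡⟨ cong ∑det (List.++-assoc pre [ J q q ] _) ⟩
      ∑det (pre ++ J q q ∷ Js (suc q) (upFrom (suc q) (suc d)) ++ [ full ]) ∎
    where
    open ≡-Reasoning
    pre′ : List Row
    pre′ = pre ++ [ J q q ]
    rest : List Row
    rest = differences (suc (suc q)) d ++ [ full ]
    below′ : All (LabelIn (_< suc q)) pre′
    below′ = All.++⁺ (All.map (λ {row} → LabelIn-map (λ s<q → ℕ.<-trans s<q (ℕ.n<1+n q)) {row}) below) (ℕ.n<1+n q ∷ [])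
    q<n : suc q ≤ n
    q<n = ℕ.≤-trans (subst (suc q ≤_) (sym (ℕ.+-suc q d)) (s≤s (ℕ.m≤m+n q d))) bound
    vanishes : ∑det (pre′ ++ J q (suc q) ∷ rest) ≡ + 0
    vanishes = trans (cong ∑det (List.++-assoc pre [ J q q ] _))
      (∑det-J-consecutive q q pre rest 1≤q q<n below (All.++⁺ (differences-above (suc q) d) (tt ∷ [])))

  mixed-step : ∀ m d → m ℕ.+ suc d ≡ n → ∑det (mixed m (suc d)) ≡ ∑det (collapsed m (suc d)) - ∑det (mixed (suc m) d)
  mixed-step m d m+d+1≡n =
    trans (∑det-J⊖J (shifted m) (suc m) m (suc m) (differences (suc (suc m)) d ++ [ full ]))
      (cong₂ _-_ (∑det-differences d (suc m) (shifted m) (s≤s z≤n) (ℕ.≤-reflexive (trans (sym (ℕ.+-suc m d)) m+d+1≡n))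
                                   (shifted-below m))
                 (cong ∑det (trans (sym (List.++-assoc (shifted m) [ J m (suc m) ] _))
                                   (cong (_++ differences (suc (suc m)) d ++ [ full ]) (sym (shifted-snoc m))))))

  collapsed-bubbled : ∀ m₀ d → suc m₀ ℕ.+ d ≡ n →
    ∑det (collapsed (suc m₀) d) ≡ sgn (m₀ ℕ.+ d) * ∑det (diagonal m₀ ++ subdiagonal m₀ d ++ J (suc n) n ∷ [ full ])
  collapsed-bubbled m₀ d m+d≡n = begin
      ∑det (J 0 1 ∷ Js 2 (upFrom 1 m₀) ++ Js (suc (suc m₀)) (upFrom (suc (suc m₀)) d) ++ [ full ])
    ≡⟨ cong (λ rows → ∑det (J 0 1 ∷ rows)) (trans (sym (List.++-assoc (Js 2 (upFrom 1 m₀)) _ [ full ]))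
                                                   (cong (_++ [ full ]) (sym (Js-is 2)))) ⟩
      ∑det ([] ++ J 0 1 ∷ Js 2 is ++ [ full ])
    ≡⟨ ∑det-bubble 0 is [] [ full ] 1 ℕ.≤-refl (ℕ.≤-reflexive 1+len≡n) [] (tt ∷ []) ⟩
      sgn (length is) * ∑det (Js 1 is ++ J 0 (suc (length is)) ∷ [ full ])
    ≡⟨ cong₂ (λ l rows → sgn l * ∑det rows) length-is
             (cong₂ (λ rows s → rows ++ J 0 s ∷ [ full ]) (Js-is 1) 1+len≡n) ⟩
      sgn (m₀ ℕ.+ d) * ∑det ((diagonal m₀ ++ subdiagonal m₀ d) ++ J 0 n ∷ [ full ])
    ≡⟨ cong (sgn (m₀ ℕ.+ d) *_) (∑det-J0≡Jk (diagonal m₀ ++ subdiagonal m₀ d) n [ full ]) ⟩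
      sgn (m₀ ℕ.+ d) * ∑det ((diagonal m₀ ++ subdiagonal m₀ d) ++ J (suc n) n ∷ [ full ])
    ≡⟨ cong (λ rows → sgn (m₀ ℕ.+ d) * ∑det rows) (List.++-assoc (diagonal m₀) (subdiagonal m₀ d) _) ⟩
      sgn (m₀ ℕ.+ d) * ∑det (diagonal m₀ ++ subdiagonal m₀ d ++ J (suc n) n ∷ [ full ]) ∎
    where
    open ≡-Reasoning
    is : List ℕ
    is = upFrom 1 m₀ ++ upFrom (suc (suc m₀)) d
    length-is : length is ≡ m₀ ℕ.+ d
    length-is = trans (List.length-++ (upFrom 1 m₀)) (cong₂ ℕ._+_ (length-upFrom 1 m₀) (length-upFrom _ d))
    1+len≡n : suc (length is) ≡ n
    1+len≡n = trans (cong suc length-is) m+d≡n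
    Js-is : ∀ q → Js q is ≡ Js q (upFrom 1 m₀) ++ Js (q ℕ.+ m₀) (upFrom (suc (suc m₀)) d)
    Js-is q = trans (Js-++ q (upFrom 1 m₀) _)
      (cong (λ q′ → Js q (upFrom 1 m₀) ++ Js (q ℕ.+ q′) (upFrom (suc (suc m₀)) d)) (length-upFrom 1 m₀))

  full-raised : ∀ m₀ d → suc m₀ ℕ.+ d ≡ n →
    ∑det (diagonal m₀ ++ subdiagonal m₀ d ++ J (suc n) n ∷ [ full ]) ≡ sgn (suc d) * ∑det (Qrows m₀ (suc d))
  full-raised m₀ d m+d≡n = begin
      ∑det (diagonal m₀ ++ subdiagonal m₀ d ++ J (suc n) n ∷ [ full ])
    ≡⟨ cong (λ rows → ∑det (diagonal m₀ ++ rows)) (sym (List.++-assoc (subdiagonal m₀ d) [ J (suc n) n ] _)) ⟩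
      ∑det (diagonal m₀ ++ (subdiagonal m₀ d ++ [ J (suc n) n ]) ++ full ∷ [])
    ≡⟨ ∑det-move (subdiagonal m₀ d ++ [ J (suc n) n ]) (diagonal m₀) full [] ⟩
      sgn (length (subdiagonal m₀ d ++ [ J (suc n) n ])) * ∑det (diagonal m₀ ++ full ∷ (subdiagonal m₀ d ++ [ J (suc n) n ]) ++ [])
    ≡⟨ cong₂ (λ l rows → sgn l * ∑det (diagonal m₀ ++ full ∷ rows)) length-tail tail ⟩
      sgn (suc d) * ∑det (Qrows m₀ (suc d)) ∎
    where
    open ≡-Reasoning
    length-tail : length (subdiagonal m₀ d ++ [ J (suc n) n ]) ≡ suc d
    length-tail = trans (List.length-++ (subdiagonal m₀ d))
      (trans (cong (ℕ._+ 1) (trans (length-Js _ (upFrom _ d)) (length-upFrom _ d))) (ℕ.+-comm d 1))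
    tail : (subdiagonal m₀ d ++ [ J (suc n) n ]) ++ [] ≡ subdiagonal m₀ (suc d)
    tail = trans (List.++-identityʳ _) (sym (trans (cong (Js (suc m₀)) (upFrom-snoc (suc (suc m₀)) d))
      (trans (Js-++ (suc m₀) (upFrom (suc (suc m₀)) d) _)
             (cong₂ (λ s i → subdiagonal m₀ d ++ [ J i s ]) (trans (cong (suc m₀ ℕ.+_) (length-upFrom _ d)) m+d≡n)
                                                             (cong suc m+d≡n)))))

  -- J 0 1 is bubbled down to the bottom, where it equals J k n, and Ω is then moved up to position a = m₀ + 1.
  collapsed≡Qrows : ∀ m₀ d → suc m₀ ℕ.+ d ≡ n → sgn (suc m₀) * ∑det (collapsed (suc m₀) d) ≡ ∑det (Qrows m₀ (suc d))
  collapsed≡Qrows m₀ d m+d≡n =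
    trans (cong (sgn (suc m₀) *_) (trans (collapsed-bubbled m₀ d m+d≡n)
                                         (cong (sgn (m₀ ℕ.+ d) *_) (full-raised m₀ d m+d≡n))))
          (signs (∑det (Qrows m₀ (suc d))))
    where
    regroup : ∀ a b x → (- a) * ((a * b) * ((- b) * x)) ≡ (a * a) * ((b * b) * x)
    regroup = solve-∀
    unit : ∀ x → + 1 * (+ 1 * x) ≡ x
    unit = solve-∀
    signs : ∀ X → sgn (suc m₀) * (sgn (m₀ ℕ.+ d) * (sgn (suc d) * X)) ≡ X
    signs X =
      trans (cong (λ s → sgn (suc m₀) * (s * (sgn (suc d) * X))) (sgn-+ m₀ d))
      (trans (regroup (sgn m₀) (sgn d) X)
      (trans (cong₂ (λ u v → u * (v * X)) (sgn-square m₀) (sgn-square d)) (unit X)))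

  ∑Q : ℕ → ℤ
  ∑Q a = ∑ (detAt (suc n) r p (Qa (suc n) r a)) (Ω (suc n) r p)

  ∑Q≡∑det : ∀ m₀ d → suc m₀ ℕ.+ d ≡ n → ∑Q (suc m₀) ≡ ∑det (Qrows m₀ (suc d))
  ∑Q≡∑det m₀ d m+d≡n =
    trans (∑detAt≡∑det (Qa (suc n) r (suc m₀)) (Qrows m₀ (n ∸ m₀)) (Qa-represented m₀ m₀≤n)) (cong (λ d′ → ∑det (Qrows m₀ d′)) n∸m₀≡1+d)
    where
    m₀+1+d≡n : m₀ ℕ.+ suc d ≡ n
    m₀+1+d≡n = trans (ℕ.+-suc m₀ d) m+d≡n
    m₀≤n : m₀ ≤ n
    m₀≤n = subst (m₀ ≤_) m₀+1+d≡n (ℕ.m≤m+n m₀ (suc d))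
    n∸m₀≡1+d : n ∸ m₀ ≡ suc d
    n∸m₀≡1+d = trans (cong (_∸ m₀) (sym m₀+1+d≡n)) (ℕ.m+n∸m≡n m₀ (suc d))

  telescope : ∀ d m₀ → suc m₀ ℕ.+ d ≡ n → sgn (suc m₀) * ∑det (mixed (suc m₀) d) ≡ ∑ ∑Q (upFrom (suc m₀) (suc d))
  telescope zero m₀ m+d≡n =
    trans (collapsed≡Qrows m₀ 0 m+d≡n) (trans (sym (∑Q≡∑det m₀ 0 m+d≡n)) (sym (ℤ.+-identityʳ _)))
  telescope (suc d) m₀ m+d≡n = begin
      sgn (suc m₀) * ∑det (mixed (suc m₀) (suc d))
    ≡⟨ cong (sgn (suc m₀) *_) (mixed-step (suc m₀) d m+d≡n) ⟩
      sgn (suc m₀) * (∑det (collapsed (suc m₀) (suc d)) - ∑det (mixed (suc (suc m₀)) d))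
    ≡⟨ distrib (sgn (suc m₀)) _ _ ⟩
      sgn (suc m₀) * ∑det (collapsed (suc m₀) (suc d)) + sgn (suc (suc m₀)) * ∑det (mixed (suc (suc m₀)) d)
    ≡⟨ cong₂ _+_ (trans (collapsed≡Qrows m₀ (suc d) m+d≡n) (sym (∑Q≡∑det m₀ (suc d) m+d≡n)))
                 (telescope d (suc m₀) (trans (sym (ℕ.+-suc (suc m₀) d)) m+d≡n)) ⟩
      ∑ ∑Q (upFrom (suc m₀) (suc (suc d))) ∎
    where
    open ≡-Reasoning
    distrib : ∀ s a b → s * (a - b) ≡ s * a + (- s) * b
    distrib = solve-∀

∑detAt-Mγ≡∑∑detAt-Qa : ∀ n₀ r (p : Vec ℕ (suc (suc n₀))) →
  ∑ (detAt (suc (suc n₀)) r p (Mγ (suc (suc n₀)) r)) (Ω (suc (suc n₀)) r p)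
    ≡ ∑ (λ a → ∑ (detAt (suc (suc n₀)) r p (Qa (suc (suc n₀)) r a)) (Ω (suc (suc n₀)) r p)) (range (suc (suc n₀)))
∑detAt-Mγ≡∑∑detAt-Qa n₀ r p = begin
    ∑ (detAt k r p (Mγ k r)) (Ω k r p)
  ≡⟨ ∑detAt≡∑det (Mγ k r) (differences 1 n ++ [ full ]) Mγ-represented ⟩
    ∑det (mixed 0 n)
  ≡⟨ mixed-step 0 n₀ refl ⟩
    ∑det (collapsed 0 n) - ∑det (mixed 1 n₀)
  ≡⟨ cong₂ _+_ (sym ∑Q-last) (sym (ℤ.-1*i≡-i (∑det (mixed 1 n₀)))) ⟩
    ∑Q k + sgn 1 * ∑det (mixed 1 n₀)
  ≡⟨ cong (_+_ (∑Q k)) (telescope n₀ 0 refl) ⟩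
    ∑Q k + ∑ ∑Q (upFrom 1 n)
  ≡⟨ ℤ.+-comm (∑Q k) _ ⟩
    ∑ ∑Q (upFrom 1 n) + ∑Q k
  ≡⟨ cong (_+_ (∑ ∑Q (upFrom 1 n))) (sym (ℤ.+-identityʳ (∑Q k))) ⟩
    ∑ ∑Q (upFrom 1 n) + ∑ ∑Q [ k ]
  ≡⟨ sym (∑-++ ∑Q (upFrom 1 n) [ k ]) ⟩
    ∑ ∑Q (upFrom 1 n ++ [ k ])
  ≡⟨ cong (∑ ∑Q) (sym (trans (range≡upFrom k) (upFrom-snoc 1 n))) ⟩
    ∑ ∑Q (range k) ∎
  where
  open ≡-Reasoning
  n = suc n₀
  k = suc n
  open Rows k r p
  open Telescoping n r p
  ∑Q-last : ∑Q k ≡ ∑det (collapsed 0 n)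
  ∑Q-last = trans (∑detAt≡∑det (Qa k r k) (Qrows n (n ∸ n)) (Qa-represented n ℕ.≤-refl)) (cong (λ d → ∑det (Qrows n d)) (ℕ.n∸n≡0 n))

lemma5p10 : (k r : ℕ) (p : Vec ℕ k) → 0 < r → r < k →
    ∃ (λ (S : Tuple k r) → inSpr k r p S ≡ true) →
    Pdet k r p (Mγ k r) ≡ sumℚ (map (λ a → Pdet k r p (Qa k r a)) (range k))
lemma5p10 zero r p 0<r ()
lemma5p10 (suc zero) (suc r) p 0<r (s≤s ())
lemma5p10 k@(suc (suc n₀)) r p _ _ _ = begin
    Pdet k r p (Mγ k r)
  ≡⟨ Pdet≡∑detAt k r p (Mγ k r) ⟩
    divℚ (∑ (detAt k r p (Mγ k r)) (Ω k r p)) (∣Ω∣ k r p)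
  ≡⟨ cong (λ z → divℚ z (∣Ω∣ k r p)) (∑detAt-Mγ≡∑∑detAt-Qa n₀ r p) ⟩
    divℚ (∑ (λ a → ∑ (detAt k r p (Qa k r a)) (Ω k r p)) (range k)) (∣Ω∣ k r p)
  ≡⟨ sym (sumℚ-divℚ (∣Ω∣ k r p) (λ a → ∑ (detAt k r p (Qa k r a)) (Ω k r p)) (range k)) ⟩
    sumℚ (map (λ a → divℚ (∑ (detAt k r p (Qa k r a)) (Ω k r p)) (∣Ω∣ k r p)) (range k))
  ≡⟨ cong sumℚ (List.map-cong (λ a → sym (Pdet≡∑detAt k r p (Qa k r a))) (range k)) ⟩
    sumℚ (map (λ a → Pdet k r p (Qa k r a)) (range k)) ∎
  where open ≡-Reasoning
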